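{- Let $G$ be a bi-block graph with $N=\sum_{k=1}^r(m_k+n_k)-r+1$ vertices and $r>1$ blocks $K_{m_k,n_k}$, and let $q$ satisfy $q\neq-1$, $q^2(m_k-1)(n_k-1)\neq1$ and $(q+1)^2(m_k-1)(n_k-1)\neq m_kn_k$ for all $k$. Let $\mathscr{D}$ be the $q$-distance matrix of $G$ and $\mathscr{L}$, $\mathbf{x}$ as defined below. Then $$\mathscr{D}\mathscr{L}+\mathbf{I}_N=\mathds{1}_N\mathbf{x}^T.$$
   Context: $q$ is a real or complex number (the paper calls it an indeterminate). For an integer $\alpha\ge1$, $[\alpha]=1+q+\cdots+q^{\alpha-1}$, $[0]=0$; the $q$-distance matrix $\mathscr{D}$ of a connected graph with vertices $v_1,\dots,v_N$ has $(i,j)$ entry $[d(v_i,v_j)]$, $d$ the shortest-path distance. A bi-block graph is a connected graph each of whose blocks (maximal connected subgraphs without a cut-vertex) is complete bipartite; its blocks are $K_{m_k,n_k}$ with a fixed bipartition $X_k\cup Y_k$, $|X_k|=m_k$, $|Y_k|=n_k$. Let $\hat d(v)$ be the number of blocks containing $v$, and $\Delta_k=q^2(m_k-1)(n_k-1)-1$. Define $\mathbf{x}(v)=\sum_{k:\,v\in X_k}\frac{q(n_k-1)-1}{(q+1)\Delta_k}+\sum_{k:\,v\in Y_k}\frac{q(m_k-1)-1}{(q+1)\Delta_k}-(\hat d(v)-1)$ and $\mathbf{y}(v)=\sum_{k:\,v\in X_k}\frac{n_k-1}{\Delta_k}+\sum_{k:\,v\in Y_k}\frac{m_k-1}{\Delta_k}-(\hat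 d(v)-1)$. Let $\mathbf{A}$ be the $N\times N$ matrix with $(u,v)$ entry $1/\Delta_k$ if $u\sim v$ and the edge $uv$ lies in block $K_{m_k,n_k}$, and $0$ otherwise. Let $\mathbf{B}$ be the $N\times N$ matrix with $(u,v)$ entry $\frac{n_k-1}{\Delta_k}$ if $u\neq v$ and $u,v\in X_k$ for some $k$, $\frac{m_k-1}{\Delta_k}$ if $u\neq v$ and $u,v\in Y_k$ for some $k$, and $0$ otherwise. Define $$\mathscr{L}=\frac{q}{q+1}\mathbf{A}-\frac{q^2}{q+1}\mathbf{B}-\frac{q^2}{q+1}\mathrm{diag}(\mathbf{y})+\frac{1}{q+1}\mathbf{I}_N.$$ $\mathds{1}_N$ is the all-ones vector. -}

module Defs where

open import Level using (Level; _⊔_) renaming (suc to lsuc)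
open import Data.Bool using (Bool; true; false; _∧_; _∨_; not; if_then_else_)
open import Data.Nat as ℕ using (ℕ; zero; suc; _≤_)
open import Data.Fin using (Fin; _≟_)
open import Data.Product using (Σ; ∃; _×_; _,_)
open import Relation.Nullary using (¬_)
open import Relation.Nullary.Decidable using (⌊_⌋)
open import Relation.Binary.PropositionalEquality using (_≡_)
open import Algebra.Bundles using (CommutativeRing; CommutativeSemiring)
import Algebra.Definitions.RawSemiring as RS

-- Fields: a commutative ring with 0 ≠ 1 in which every nonzero element
-- is invertible.  The inverse is a total operation whose value at 0 is
-- irrelevant (only ever used on nonzero elements).

record Field (c ℓ : Level) : Set (lsuc (c ⊔ ℓ)) where
  field
    commutativeRing : CommutativeRing c ℓ
  open CommutativeRing commutativeRing public
  infix 8 _⁻¹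
  field
    _⁻¹      : Carrier → Carrier
    inverseʳ : ∀ x → ¬ (x ≈ 0#) → x * (x ⁻¹) ≈ 1#
    0≉1      : ¬ (0# ≈ 1#)

record Graph (N : ℕ) : Set where
  field
    adj    : Fin N → Fin N → Bool
    sym    : ∀ u v → adj u v ≡ adj v u
    irrefl : ∀ v → adj v v ≡ false

Subset : ℕ → Set
Subset N = Fin N → Bool

_∈ₛ_ : ∀ {N} → Fin N → Subset N → Set
v ∈ₛ S = S v ≡ true

_⊆ₛ_ : ∀ {N} → Subset N → Subset N → Set
S ⊆ₛ T = ∀ v → v ∈ₛ S → v ∈ₛ T

fullSet : ∀ {N} → Subset N
fullSet _ = true

_∖ₛ_ : ∀ {N} → Subset N → Fin N → Subset N
(S ∖ₛ v) w = S w ∧ not ⌊ w ≟ v ⌋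

count : ∀ {N} → Subset N → ℕ
count {zero}  S = 0
count {suc N} S = (if S Fin.zero then 1 else 0) ℕ.+ count (λ i → S (Fin.suc i))
  where import Data.Fin as Fin

sumℕ : ∀ {r} → (Fin r → ℕ) → ℕ
sumℕ {zero}  f = 0
sumℕ {suc r} f = f Fin.zero ℕ.+ sumℕ (λ i → f (Fin.suc i))
  where import Data.Fin as Fin

module _ {N : ℕ} (G : Graph N) where
  open Graph G

  data Walk (S : Subset N) : Fin N → Fin N → ℕ → Set where
    here : ∀ {v} → v ∈ₛ S → Walk S v v 0
    step : ∀ {u w v l} → u ∈ₛ S → adj u w ≡ true → Walk S w v l →
           Walk S u v (suc l)

  ConnectedOn : Subset N → Set
  ConnectedOn S = ∀ u v → u ∈ₛ S → v ∈ₛ S → ∃ λ l → Walk S u v l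

  Connected : Set
  Connected = ConnectedOn fullSet

  IsDistance : (Fin N → Fin N → ℕ) → Set
  IsDistance d = ∀ u v → Walk fullSet u v (d u v) × (∀ l → Walk fullSet u v l → d u v ≤ l)

  -- G[S] is connected and has no cut-vertex (for a connected graph H,
  -- v is a cut-vertex iff H - v is disconnected)
  NoCutVertex : Subset N → Set
  NoCutVertex S = ConnectedOn S × (∀ v → v ∈ₛ S → ConnectedOn (S ∖ₛ v))

  -- S is (the vertex set of) a block: a maximal connected subgraph without
  -- a cut-vertex.  Blocks are induced subgraphs, so they are determined by
  -- their vertex sets.
  IsBlock : Subset N → Set
  IsBlock S = (∃ λ v → v ∈ₛ S) × NoCutVertex S × (∀ T → NoCutVertex T → S ⊆ₛ T → T ⊆ₛ S)

_∪ₛ_ : ∀ {N} → Subset N → Subset N → Subset N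
(S ∪ₛ T) v = S v ∨ T v

record BiBlockGraph (N r : ℕ) : Set where
  field
    graph : Graph N
    X Y   : Fin r → Subset N
    connected  : Connected graph
    disjoint   : ∀ k v → v ∈ₛ X k → ¬ (v ∈ₛ Y k)
    XY-adj     : ∀ k u v → u ∈ₛ X k → v ∈ₛ Y k → Graph.adj graph u v ≡ true
    XX-nonadj  : ∀ k u v → u ∈ₛ X k → v ∈ₛ X k → Graph.adj graph u v ≡ false
    YY-nonadj  : ∀ k u v → u ∈ₛ Y k → v ∈ₛ Y k → Graph.adj graph u v ≡ false
    blocks-are : ∀ k → IsBlock graph (X k ∪ₛ Y k)
    blocks-all : ∀ S → IsBlock graph S → ∃ λ k → ∀ v → S v ≡ (X k ∪ₛ Y k) v
    blocks-distinct : ∀ k l → (∀ v → (X k ∪ₛ Y k) v ≡ (X l ∪ₛ Y l) v) → k ≡ l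
  open Graph graph public
  Bl : Fin r → Subset N
  Bl k = X k ∪ₛ Y k
  m n : Fin r → ℕ
  m k = count (X k)
  n k = count (Y k)

module QData {c ℓ} (F : Field c ℓ) where
  open Field F
  open RS (CommutativeSemiring.rawSemiring commutativeSemiring) public using (sum; _^_) renaming (_×_ to _·_)

  Matrix : ℕ → Set c
  Matrix N = Fin N → Fin N → Carrier

  ι : ℕ → Carrier
  ι k = k · 1#

  ind : Bool → Carrier
  ind b = if b then 1# else 0#

  _/_ : Carrier → Carrier → Carrier
  x / y = x * (y ⁻¹)

  qnum : Carrier → ℕ → Carrier
  qnum q zero    = 0#
  qnum q (suc α) = qnum q α + q ^ α

  _⊗_ : ∀ {N} → Matrix N → Matrix N → Matrix N
  (P ⊗ Q) i j = sum (λ l → P i l * Q l j)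

  _⊕_ : ∀ {N} → Matrix N → Matrix N → Matrix N
  (P ⊕ Q) i j = P i j + Q i j

  Id : ∀ {N} → Matrix N
  Id i j = ind ⌊ i ≟ j ⌋

  module _ {N r : ℕ} (G : BiBlockGraph N r) (q : Carrier) where
    open BiBlockGraph G

    Δ : Fin r → Carrier
    Δ k = q * q * (ι (m k) - 1#) * (ι (n k) - 1#) - 1#

    dhat : Fin N → Carrier
    dhat v = sum (λ k → ind (Bl k v))

    xvec : Fin N → Carrier
    xvec v = sum (λ k → ind (X k v) * ((q * (ι (n k) - 1#) - 1#) / ((q + 1#) * Δ k)))
           + sum (λ k → ind (Y k v) * ((q * (ι (m k) - 1#) - 1#) / ((q + 1#) * Δ k)))
           - (dhat v - 1#)

    yvec : Fin N → Carrier
    yvec v = sum (λ k → ind (X k v) * ((ι (n k) - 1#) / Δ k))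
           + sum (λ k → ind (Y k v) * ((ι (m k) - 1#) / Δ k))
           - (dhat v - 1#)

    -- (u,v) entry 1/Δ_k if uv is an edge of the block K_{m_k,n_k}
    -- (an edge lies in exactly one block, so the sum has at most one nonzero term)
    Amat : Matrix N
    Amat u v = sum (λ k → ind (adj u v ∧ Bl k u ∧ Bl k v) * (1# / Δ k))

    -- two distinct vertices lie in at most one common block
    Bmat : Matrix N
    Bmat u v = sum (λ k → ind (not ⌊ u ≟ v ⌋ ∧ X k u ∧ X k v) * ((ι (n k) - 1#) / Δ k)
                        + ind (not ⌊ u ≟ v ⌋ ∧ Y k u ∧ Y k v) * ((ι (m k) - 1#) / Δ k))

    𝓛 : Matrix N
    𝓛 u v = (q / (q + 1#)) * Amat u v
          - ((q * q) / (q + 1#)) * Bmat u v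
          - ((q * q) / (q + 1#)) * (ind ⌊ u ≟ v ⌋ * yvec u)
          + (1# / (q + 1#)) * Id u v

    𝓓 : (Fin N → Fin N → ℕ) → Matrix N
    𝓓 d u v = qnum q (d u v)

-- Fix the row i. In every block the vertex nearest to i, its gate, lies on all geodesics from i
-- into the block, so the other vertices are one step further than the gate on the opposite side
-- and two steps further on the gate's side. As 𝓛 only links vertices of a common block, row i of
-- 𝓓𝓛 splits into block contributions, and with these distances block k contributes its share of
-- x(j), plus q^d(i,j) when j is a vertex of block k other than its gate. A vertex j ≠ i is such a
-- non-gate in exactly one block and i in none (this is where the count of N enters), and the
-- remaining diagonal terms cancel because q^d = 1 + (q - 1)[d].

module Submission where

open import Defs
open import Data.Nat as ℕ using (ℕ; _<_)
open import Data.Fin using (Fin)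
open import Relation.Nullary using (¬_)
open import Relation.Binary.PropositionalEquality using (_≡_)

open import Algebra.Bundles using (CommutativeRing)
open import Data.Bool using (Bool; true; false; _∧_; _∨_; not; if_then_else_)
open import Data.Bool.Properties using (∧-zeroʳ; ∧-identityʳ; ∨-comm; ¬-not)
open import Data.Empty using (⊥; ⊥-elim)
open import Data.Fin as Fin using (_≟_)
open import Data.Fin.Properties using (suc-injective; 0≢1+n)
open import Data.Integer using (+_)
open import Data.Nat using (zero; suc; _≤_; z≤n; s≤s; _≤?_)
import Data.Nat.Properties as ℕ
open import Data.Nat.Properties
  using ( ≤-refl; ≤-antisym; ≤-trans; ≤-reflexive; <⇒≤; ≰⇒>; <⇒≱; n≤0⇒n≡0; 1+n≰n; n≮0
        ; m≤m+n; m<m+n; +-mono-≤; +-mono-<-≤; +-cancelˡ-≤; +-cancelʳ-≡; m≤n⇒m<n∨m≡n; m+n∸n≡m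
        ; +-commutativeSemigroup )
open import Algebra.Properties.CommutativeSemigroup +-commutativeSemigroup
  using () renaming (interchange to +-interchange)
open import Data.Product using (Σ; ∃; ∃₂; _×_; _,_; proj₁; proj₂; map₂)
open import Data.Sum as Sum using (_⊎_; inj₁; inj₂; [_,_]; map₁)
open import Data.Unit using (⊤)
open import Function using (_∘_)
open import Relation.Nullary using (Dec; yes; no)
open import Relation.Nullary.Decidable using (⌊_⌋; _⊎-dec_)
open import Relation.Binary.PropositionalEquality as ≡ using (_≢_; refl; trans; cong; cong₂; subst)

∨-trueˡ : ∀ {a} b → a ≡ true → a ∨ b ≡ true
∨-trueˡ b refl = refl

∨-trueʳ : ∀ a {b} → b ≡ true → a ∨ b ≡ true
∨-trueʳ false b≡true = b≡true
∨-trueʳ true  _      = refl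

∨-true⁻ : ∀ a {b} → a ∨ b ≡ true → a ≡ true ⊎ b ≡ true
∨-true⁻ true  _      = inj₁ refl
∨-true⁻ false b≡true = inj₂ b≡true

∧-true : ∀ {a b} → a ≡ true → b ≡ true → a ∧ b ≡ true
∧-true refl refl = refl

∧-true⁻ˡ : ∀ a {b} → a ∧ b ≡ true → a ≡ true
∧-true⁻ˡ true _ = refl

∧-true⁻ʳ : ∀ a {b} → a ∧ b ≡ true → b ≡ true
∧-true⁻ʳ true b≡true = b≡true

true⇒≢false : ∀ {a} → a ≡ true → a ≢ false
true⇒≢false refl ()

bool-ext : ∀ {a b} → (a ≡ true → b ≡ true) → (b ≡ true → a ≡ true) → a ≡ b
bool-ext {true}          a⇒b _   = ≡.sym (a⇒b refl)
bool-ext {false} {true}  _   b⇒a = b⇒a refl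
bool-ext {false} {false} _   _   = refl

isYes-true : ∀ {A : Set} (a? : Dec A) → A → ⌊ a? ⌋ ≡ true
isYes-true (yes _)  _ = refl
isYes-true (no ¬a) a = ⊥-elim (¬a a)

isYes-true⁻ : ∀ {A : Set} (a? : Dec A) → ⌊ a? ⌋ ≡ true → A
isYes-true⁻ (yes a) _ = a

isYes-false : ∀ {A : Set} (a? : Dec A) → ¬ A → ⌊ a? ⌋ ≡ false
isYes-false (yes a) ¬a = ⊥-elim (¬a a)
isYes-false (no _)  _  = refl

not-true⁻ : ∀ {a} → not a ≡ true → a ≡ false
not-true⁻ {false} _ = refl

≢⇒not-≟ : ∀ {N} {u v : Fin N} → u ≢ v → not ⌊ u ≟ v ⌋ ≡ true
≢⇒not-≟ {u = u} {v} u≢v = cong not (isYes-false (u ≟ v) u≢v)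

not-≟⇒≢ : ∀ {N} {u v : Fin N} → not ⌊ u ≟ v ⌋ ≡ true → u ≢ v
not-≟⇒≢ {u = u} {v} u≉v u≡v = true⇒≢false u≉v (cong not (isYes-true (u ≟ v) u≡v))

⌊suc≟suc⌋ : ∀ {n} (i w : Fin n) → ⌊ Fin.suc i ≟ Fin.suc w ⌋ ≡ ⌊ i ≟ w ⌋
⌊suc≟suc⌋ i w with i ≟ w
... | yes _ = refl
... | no  _ = refl

module _ {N : ℕ} (S : Subset N) {v w : Fin N} where

  ∈-∖ₛ : v ∈ₛ S → v ≢ w → v ∈ₛ (S ∖ₛ w)
  ∈-∖ₛ v∈S v≢w = ∧-true v∈S (≢⇒not-≟ v≢w)

  ∈-∖ₛ⁻ : v ∈ₛ (S ∖ₛ w) → v ∈ₛ S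
  ∈-∖ₛ⁻ = ∧-true⁻ˡ (S v)

  ∈-∖ₛ⁻-≢ : v ∈ₛ (S ∖ₛ w) → v ≢ w
  ∈-∖ₛ⁻-≢ v∈S∖w = not-≟⇒≢ (∧-true⁻ʳ (S v) v∈S∖w)

∖ₛ-mono : ∀ {N} {S T : Subset N} {w} → S ⊆ₛ T → (S ∖ₛ w) ⊆ₛ (T ∖ₛ w)
∖ₛ-mono {S = S} {T} S⊆T z z∈ = ∈-∖ₛ T (S⊆T z (∈-∖ₛ⁻ S z∈)) (∈-∖ₛ⁻-≢ S z∈)

∁ : ∀ {N} → Subset N → Subset N
∁ S v = not (S v)

module Walks {N : ℕ} (G : Graph N) where
  open Graph G renaming (sym to adj-sym)

  infix 4 _∈ʷ_ _∈ʷ?_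
  infixr 5 _++_

  _∈ʷ_ : ∀ {S x y l} → Fin N → Walk G S x y l → Set
  z ∈ʷ here {v} _     = z ≡ v
  z ∈ʷ step {u} _ _ w = z ≡ u ⊎ z ∈ʷ w

  _∈ʷ?_ : ∀ {S x y l} (z : Fin N) (w : Walk G S x y l) → Dec (z ∈ʷ w)
  z ∈ʷ? here {v} _     = z ≟ v
  z ∈ʷ? step {u} _ _ w = z ≟ u ⊎-dec z ∈ʷ? w

  start-∈ʷ : ∀ {S x y l} (w : Walk G S x y l) → x ∈ʷ w
  start-∈ʷ (here _)     = refl
  start-∈ʷ (step _ _ _) = inj₁ refl

  end-∈ʷ : ∀ {S x y l} (w : Walk G S x y l) → y ∈ʷ w
  end-∈ʷ (here _)     = refl
  end-∈ʷ (step _ _ w) = inj₂ (end-∈ʷ w)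

  ∈ʷ⇒∈ₛ : ∀ {S x y l z} (w : Walk G S x y l) → z ∈ʷ w → z ∈ₛ S
  ∈ʷ⇒∈ₛ (here v∈S)     refl        = v∈S
  ∈ʷ⇒∈ₛ (step u∈S _ _) (inj₁ refl) = u∈S
  ∈ʷ⇒∈ₛ (step _ _ w)   (inj₂ z∈w)  = ∈ʷ⇒∈ₛ w z∈w

  restrict : ∀ {S T x y l} (w : Walk G S x y l) → (∀ {z} → z ∈ʷ w → z ∈ₛ T) → Walk G T x y l
  restrict (here _)     ⊆T = here (⊆T refl)
  restrict (step _ a w) ⊆T = step (⊆T (inj₁ refl)) a (restrict w (⊆T ∘ inj₂))

  weaken : ∀ {S T x y l} → S ⊆ₛ T → Walk G S x y l → Walk G T x y l
  weaken S⊆T w = restrict w (λ z∈w → S⊆T _ (∈ʷ⇒∈ₛ w z∈w))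

  _++_ : ∀ {S x y z a b} → Walk G S x y a → Walk G S y z b → Walk G S x z (a ℕ.+ b)
  here _     ++ w′ = w′
  step p e w ++ w′ = step p e (w ++ w′)

  ∈ʷ-++⁻ : ∀ {S x y z a b v} (w : Walk G S x y a) (w′ : Walk G S y z b) →
           v ∈ʷ w ++ w′ → v ∈ʷ w ⊎ v ∈ʷ w′
  ∈ʷ-++⁻ (here _)     w′ v∈            = inj₂ v∈
  ∈ʷ-++⁻ (step _ _ w) w′ (inj₁ v≡u)    = inj₁ (inj₁ v≡u)
  ∈ʷ-++⁻ (step _ _ w) w′ (inj₂ v∈)     = map₁ inj₂ (∈ʷ-++⁻ w w′ v∈)

  cast : ∀ {S x y l l′} → l ≡ l′ → Walk G S x y l → Walk G S x y l′
  cast refl w = w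

  ∈ʷ-cast⁻ : ∀ {S x y l l′ v} (e : l ≡ l′) (w : Walk G S x y l) → v ∈ʷ cast e w → v ∈ʷ w
  ∈ʷ-cast⁻ refl w v∈ = v∈

  snoc : ∀ {S x y z l} → Walk G S x y l → z ∈ₛ S → adj y z ≡ true → Walk G S x z (suc l)
  snoc {l = l} w z∈S a = cast (ℕ.+-comm l 1) (w ++ step (∈ʷ⇒∈ₛ w (end-∈ʷ w)) a (here z∈S))

  ∈ʷ-snoc⁻ : ∀ {S x y z l v} (w : Walk G S x y l) (z∈S : z ∈ₛ S) (a : adj y z ≡ true) →
             v ∈ʷ snoc w z∈S a → v ∈ʷ w ⊎ v ≡ z
  ∈ʷ-snoc⁻ {l = l} w z∈S a v∈ with ∈ʷ-++⁻ w _ (∈ʷ-cast⁻ (ℕ.+-comm l 1) _ v∈)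
  ... | inj₁ v∈w          = inj₁ v∈w
  ... | inj₂ (inj₁ refl)  = inj₁ (end-∈ʷ w)
  ... | inj₂ (inj₂ v≡z)   = inj₂ v≡z

  reverse : ∀ {S x y l} → Walk G S x y l → Walk G S y x l
  reverse (here p)     = here p
  reverse (step p a w) = snoc (reverse w) p (trans (adj-sym _ _) a)

  ∈ʷ-reverse⁻ : ∀ {S x y l v} (w : Walk G S x y l) → v ∈ʷ reverse w → v ∈ʷ w
  ∈ʷ-reverse⁻ (here _)     v∈ = v∈
  ∈ʷ-reverse⁻ (step p a w) v∈ with ∈ʷ-snoc⁻ (reverse w) p _ v∈
  ... | inj₁ v∈w = inj₂ (∈ʷ-reverse⁻ w v∈w)
  ... | inj₂ v≡u = inj₁ v≡u

  unsnoc : ∀ {S x y l} → Walk G S x y (suc l) → ∃ λ c → Walk G S x c l × adj c y ≡ true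
  unsnoc (step p a (here _))     = _ , here p , a
  unsnoc (step p a (step q b w)) with unsnoc (step q b w)
  ... | c , w′ , c~y = c , step p a w′ , c~y

  record Split {S x y l} (w : Walk G S x y l) (z : Fin N) : Set where
    field
      {l₁ l₂}  : ℕ
      prefix   : Walk G S x z l₁
      suffix   : Walk G S z y l₂
      length   : l₁ ℕ.+ l₂ ≡ l
      prefix-⊆ : ∀ {v} → v ∈ʷ prefix → v ∈ʷ w
      suffix-⊆ : ∀ {v} → v ∈ʷ suffix → v ∈ʷ w

  splitAt : ∀ {S x y l z} (w : Walk G S x y l) → z ∈ʷ w → Split w z
  splitAt (here p) refl = record
    { prefix = here p ; suffix = here p ; length = refl ; prefix-⊆ = λ v∈ → v∈ ; suffix-⊆ = λ v∈ → v∈ }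
  splitAt (step p a w) (inj₁ refl) = record
    { prefix = here p ; suffix = step p a w ; length = refl ; prefix-⊆ = inj₁ ; suffix-⊆ = λ v∈ → v∈ }
  splitAt (step p a w) (inj₂ z∈w) = record
    { prefix   = step p a prefix
    ; suffix   = suffix
    ; length   = cong suc length
    ; prefix-⊆ = λ { (inj₁ v≡u) → inj₁ v≡u ; (inj₂ v∈) → inj₂ (prefix-⊆ v∈) }
    ; suffix-⊆ = inj₂ ∘ suffix-⊆
    }
    where open Split (splitAt w z∈w)

  IsPath : ∀ {S x y l} → Walk G S x y l → Set
  IsPath (here _)         = ⊤
  IsPath (step {u} _ _ w) = ¬ u ∈ʷ w × IsPath w

  private
    pathFrom : ∀ {S x y l z} (w : Walk G S x y l) → IsPath w → z ∈ʷ w →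
               ∃₂ λ l′ (p : Walk G S z y l′) → IsPath p
    pathFrom (step p a w) w-path (inj₁ refl) = _ , step p a w , w-path
    pathFrom (here p)     w-path refl        = _ , here p , w-path
    pathFrom (step p a w) w-path (inj₂ z∈w)  = pathFrom w (proj₂ w-path) z∈w

  toPath : ∀ {S x y l} → Walk G S x y l → ∃₂ λ l′ (p : Walk G S x y l′) → IsPath p
  toPath (here p) = _ , here p , _
  toPath (step {u} p a w) with toPath w
  ... | _ , w′ , w′-path with u ∈ʷ? w′
  ...   | yes u∈w′ = pathFrom w′ w′-path u∈w′
  ...   | no  u∉w′ = _ , step p a w′ , u∉w′ , w′-path

  splitAt-disjoint : ∀ {S x y l z v} (w : Walk G S x y l) → IsPath w → (z∈w : z ∈ʷ w) →
                     let open Split (splitAt w z∈w) in v ∈ʷ prefix → v ∈ʷ suffix → v ≡ z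
  splitAt-disjoint (here p)     _      refl        v∈₁          _   = v∈₁
  splitAt-disjoint (step p a w) _      (inj₁ refl) v∈₁          _   = v∈₁
  splitAt-disjoint (step p a w) w-path (inj₂ z∈w)  (inj₁ refl)  v∈₂ =
    ⊥-elim (proj₁ w-path (Split.suffix-⊆ (splitAt w z∈w) v∈₂))
  splitAt-disjoint (step p a w) w-path (inj₂ z∈w)  (inj₂ v∈₁)   v∈₂ =
    splitAt-disjoint w (proj₂ w-path) z∈w v∈₁ v∈₂

module Blocks {N : ℕ} (G : Graph N) where
  open Graph G
  open Walks G

  connectedOn-hub : ∀ {T} h → (∀ {u} → u ∈ₛ T → ∃ (Walk G T u h)) → ConnectedOn G T
  connectedOn-hub h to-h u v u∈T v∈T with to-h u∈T | to-h v∈T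
  ... | _ , p | _ , q = _ , p ++ reverse q

  module _ {S : Subset N} (blk : IsBlock G S) where

    block-connected : ConnectedOn G S
    block-connected = proj₁ (proj₁ (proj₂ blk))

    block-connected-∖ : ∀ v → v ∈ₛ S → ConnectedOn G (S ∖ₛ v)
    block-connected-∖ = proj₂ (proj₁ (proj₂ blk))

    block-maximal : ∀ T → NoCutVertex G T → S ⊆ₛ T → T ⊆ₛ S
    block-maximal = proj₂ (proj₂ blk)

    walk-avoiding : ∀ {w u h} → u ∈ₛ S → h ∈ₛ S → u ≢ w → h ≢ w → ∃ (Walk G (S ∖ₛ w) u h)
    walk-avoiding {w} {u} {h} u∈S h∈S u≢w h≢w with S w in w∈S?
    ... | true  = block-connected-∖ w w∈S? u h (∈-∖ₛ S u∈S u≢w) (∈-∖ₛ S h∈S h≢w)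
    ... | false = map₂ (weaken S⊆S∖w) (block-connected u h u∈S h∈S)
      where
      S⊆S∖w : S ⊆ₛ (S ∖ₛ w)
      S⊆S∖w z z∈S = ∈-∖ₛ S z∈S λ { refl → true⇒≢false z∈S w∈S? }

  -- An ear of S: a path outside S joining neighbours of two distinct vertices s, t of S.
  -- S together with the ear has no cut-vertex, contradicting the maximality of the block S.
  module Ear {S : Subset N} {s t x y : Fin N} {l : ℕ}
             (blk : IsBlock G S) (s∈S : s ∈ₛ S) (t∈S : t ∈ₛ S) (s≢t : s ≢ t)
             (s~x : adj s x ≡ true) (E : Walk G (∁ S) x y l) (E-path : IsPath E) (y~t : adj y t ≡ true) where

    C : Subset N
    C v = S v ∨ ⌊ v ∈ʷ? E ⌋

    S⊆C : S ⊆ₛ C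
    S⊆C _ v∈S = ∨-trueˡ _ v∈S

    E⊆C : ∀ {v} → v ∈ʷ E → v ∈ₛ C
    E⊆C {v} v∈E = ∨-trueʳ (S v) (isYes-true (v ∈ʷ? E) v∈E)

    C-cases : ∀ {v} → v ∈ₛ C → v ∈ₛ S ⊎ v ∈ʷ E
    C-cases {v} v∈C = Sum.map₂ (isYes-true⁻ (v ∈ʷ? E)) (∨-true⁻ (S v) v∈C)

    E-outside : ∀ {v} → v ∈ʷ E → S v ≡ false
    E-outside v∈E = not-true⁻ (∈ʷ⇒∈ₛ E v∈E)

    E-≢-S : ∀ {u v} → u ∈ʷ E → v ∈ₛ S → u ≢ v
    E-≢-S u∈E v∈S refl = true⇒≢false v∈S (E-outside u∈E)

    module _ {u : Fin N} (u∈E : u ∈ʷ E) where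
      open Split (splitAt E u∈E)

      back-to-s : ∀ {T} → (∀ {z} → z ∈ʷ E → z ∈ʷ prefix → z ∈ₛ T) → s ∈ₛ T → ∃ (Walk G T u s)
      back-to-s ⊆T s∈T = _ , reverse (step s∈T s~x (restrict prefix λ z∈ → ⊆T (prefix-⊆ z∈) z∈))

      on-to-t : ∀ {T} → (∀ {z} → z ∈ʷ E → z ∈ʷ suffix → z ∈ₛ T) → t ∈ₛ T → ∃ (Walk G T u t)
      on-to-t ⊆T t∈T = _ , snoc (restrict suffix λ z∈ → ⊆T (suffix-⊆ z∈) z∈) t∈T y~t

    C-connected : ConnectedOn G C
    C-connected = connectedOn-hub s to-s
      where
      to-s : ∀ {u} → u ∈ₛ C → ∃ (Walk G C u s)
      to-s u∈C with C-cases u∈C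
      ... | inj₁ u∈S = map₂ (weaken S⊆C) (block-connected blk _ _ u∈S s∈S)
      ... | inj₂ u∈E = back-to-s u∈E (λ z∈E _ → E⊆C z∈E) (S⊆C _ s∈S)

    via-hub-in-S : ∀ {v h} → h ∈ₛ S → h ≢ v →
                   (∀ {u} → u ∈ʷ E → u ≢ v → ∃ (Walk G (C ∖ₛ v) u h)) → ConnectedOn G (C ∖ₛ v)
    via-hub-in-S {v} {h} h∈S h≢v from-E = connectedOn-hub h to-h
      where
      to-h : ∀ {u} → u ∈ₛ (C ∖ₛ v) → ∃ (Walk G (C ∖ₛ v) u h)
      to-h u∈ with C-cases (∈-∖ₛ⁻ C u∈)
      ... | inj₁ u∈S = map₂ (weaken (∖ₛ-mono S⊆C)) (walk-avoiding blk u∈S h∈S (∈-∖ₛ⁻-≢ C u∈) h≢v)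
      ... | inj₂ u∈E = from-E u∈E (∈-∖ₛ⁻-≢ C u∈)

    C∖-connected : ∀ v → v ∈ₛ C → ConnectedOn G (C ∖ₛ v)
    C∖-connected v v∈C with C-cases v∈C | s ≟ v
    ... | inj₁ v∈S | no s≢v = via-hub-in-S s∈S s≢v λ u∈E _ →
      back-to-s u∈E (λ z∈E _ → ∈-∖ₛ C (E⊆C z∈E) (E-≢-S z∈E v∈S)) (∈-∖ₛ C (S⊆C _ s∈S) s≢v)
    ... | inj₁ v∈S | yes refl = via-hub-in-S t∈S (s≢t ∘ ≡.sym) λ u∈E _ →
      on-to-t u∈E (λ z∈E _ → ∈-∖ₛ C (E⊆C z∈E) (E-≢-S z∈E v∈S)) (∈-∖ₛ C (S⊆C _ t∈S) (s≢t ∘ ≡.sym))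
    ... | inj₂ v∈E | _ = via-hub-in-S s∈S (E-≢-S v∈E s∈S ∘ ≡.sym) from-E
      where
      S⊆C∖v : S ⊆ₛ (C ∖ₛ v)
      S⊆C∖v z z∈S = ∈-∖ₛ C (S⊆C z z∈S) (E-≢-S v∈E z∈S ∘ ≡.sym)

      from-E : ∀ {u} → u ∈ʷ E → u ≢ v → ∃ (Walk G (C ∖ₛ v) u s)
      from-E u∈E u≢v with v ∈ʷ? Split.prefix (splitAt E u∈E)
      ... | no v∉prefix =
        back-to-s u∈E (λ z∈E z∈prefix → ∈-∖ₛ C (E⊆C z∈E) λ { refl → v∉prefix z∈prefix }) (S⊆C∖v s s∈S)
      ... | yes v∈prefix
        with on-to-t u∈E (λ z∈E z∈suffix → ∈-∖ₛ C (E⊆C z∈E) λ { refl →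
                            u≢v (≡.sym (splitAt-disjoint E E-path u∈E v∈prefix z∈suffix)) })
                         (S⊆C∖v t t∈S)
           | block-connected blk t s t∈S s∈S
      ...  | _ , u⇝t | _ , t⇝s = _ , u⇝t ++ weaken S⊆C∖v t⇝s

    absurd : ⊥
    absurd = true⇒≢false (block-maximal blk C (C-connected , C∖-connected) S⊆C x (E⊆C (start-∈ʷ E)))
                         (E-outside (start-∈ʷ E))

  no-ear : ∀ {S s t x y l} → IsBlock G S → s ∈ₛ S → t ∈ₛ S → s ≢ t → adj s x ≡ true →
           Walk G (∁ S) x y l → adj y t ≡ true → ⊥
  no-ear blk s∈S t∈S s≢t s~x E y~t with toPath E
  ... | _ , P , P-path = Ear.absurd blk s∈S t∈S s≢t s~x P P-path y~t

  -- A walk that starts in the block S, avoids b ∈ S and ends at a neighbour of b ends in S: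
  -- an excursion out of S must return to the vertex where it left S, as otherwise it is an ear.
  module _ {S : Subset N} {b : Fin N} (blk : IsBlock G S) (b∈S : b ∈ₛ S) where
    mutual
      end-∈-block : ∀ {a c l} (R : Walk G fullSet a c l) → a ∈ₛ S → ¬ b ∈ʷ R → adj c b ≡ true → c ∈ₛ S
      end-∈-block (here _) a∈S _ _ = a∈S
      end-∈-block (step {w = a′} _ a~a′ R) a∈S b∉R c~b with S a′ in a′∈S?
      ... | true  = end-∈-block R a′∈S? (b∉R ∘ inj₂) c~b
      ... | false = end-∈-block-excursion a∈S (λ a≡b → b∉R (inj₁ (≡.sym a≡b))) a~a′
                      (here (cong not a′∈S?)) R (b∉R ∘ inj₂) c~b

      end-∈-block-excursion : ∀ {s x a c m l} → s ∈ₛ S → s ≢ b → adj s x ≡ true → Walk G (∁ S) x a m →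
                              (R : Walk G fullSet a c l) → ¬ b ∈ʷ R → adj c b ≡ true → c ∈ₛ S
      end-∈-block-excursion s∈S s≢b s~x E (here _) _ c~b = ⊥-elim (no-ear blk s∈S b∈S s≢b s~x E c~b)
      end-∈-block-excursion {s} s∈S s≢b s~x E (step {w = a′} _ a~a′ R) b∉R c~b with S a′ in a′∈S?
      ... | false = end-∈-block-excursion s∈S s≢b s~x (snoc E (cong not a′∈S?) a~a′) R (b∉R ∘ inj₂) c~b
      ... | true with a′ ≟ s
      ...   | yes refl = end-∈-block R a′∈S? (b∉R ∘ inj₂) c~b
      ...   | no a′≢s  = ⊥-elim (no-ear blk s∈S a′∈S? (a′≢s ∘ ≡.sym) s~x E a~a′)

  blocks-sharing-two-⊆ : ∀ {S₁ S₂ u v} → IsBlock G S₁ → IsBlock G S₂ → u ≢ v →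
                         u ∈ₛ S₁ → v ∈ₛ S₁ → u ∈ₛ S₂ → v ∈ₛ S₂ → S₂ ⊆ₛ S₁
  blocks-sharing-two-⊆ {S₁} {S₂} {u} {v} blk₁ blk₂ u≢v u∈S₁ v∈S₁ u∈S₂ v∈S₂ z z∈S₂ =
    block-maximal blk₁ U (U-connected , U∖-connected) S₁⊆U z (∨-trueʳ (S₁ z) z∈S₂)
    where
    U : Subset N
    U = S₁ ∪ₛ S₂

    S₁⊆U : S₁ ⊆ₛ U
    S₁⊆U _ = ∨-trueˡ _

    S₂⊆U : S₂ ⊆ₛ U
    S₂⊆U y = ∨-trueʳ (S₁ y)

    U-connected : ConnectedOn G U
    U-connected = connectedOn-hub u λ {y} y∈U →
      [ (λ y∈S₁ → map₂ (weaken S₁⊆U) (block-connected blk₁ _ _ y∈S₁ u∈S₁))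
      , (λ y∈S₂ → map₂ (weaken S₂⊆U) (block-connected blk₂ _ _ y∈S₂ u∈S₂)) ] (∨-true⁻ (S₁ y) y∈U)

    via : ∀ {w} h → h ∈ₛ S₁ → h ∈ₛ S₂ → h ≢ w → ConnectedOn G (U ∖ₛ w)
    via h h∈S₁ h∈S₂ h≢w = connectedOn-hub h λ {y} y∈ →
      [ (λ y∈S₁ → map₂ (weaken (∖ₛ-mono S₁⊆U)) (walk-avoiding blk₁ y∈S₁ h∈S₁ (∈-∖ₛ⁻-≢ U y∈) h≢w))
      , (λ y∈S₂ → map₂ (weaken (∖ₛ-mono S₂⊆U)) (walk-avoiding blk₂ y∈S₂ h∈S₂ (∈-∖ₛ⁻-≢ U y∈) h≢w)) ]
      (∨-true⁻ (S₁ y) (∈-∖ₛ⁻ U y∈))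

    U∖-connected : ∀ w → w ∈ₛ U → ConnectedOn G (U ∖ₛ w)
    U∖-connected w _ with u ≟ w
    ... | yes refl = via v v∈S₁ v∈S₂ (u≢v ∘ ≡.sym)
    ... | no u≢w   = via u u∈S₁ u∈S₂ u≢w

indℕ : Bool → ℕ
indℕ b = if b then 1 else 0

sumℕ-cong : ∀ {n} {f g : Fin n → ℕ} → (∀ i → f i ≡ g i) → sumℕ f ≡ sumℕ g
sumℕ-cong {zero}  _   = refl
sumℕ-cong {suc n} f≗g = cong₂ ℕ._+_ (f≗g Fin.zero) (sumℕ-cong (f≗g ∘ Fin.suc))

sumℕ-+ : ∀ {n} (f g : Fin n → ℕ) → sumℕ (λ i → f i ℕ.+ g i) ≡ sumℕ f ℕ.+ sumℕ g
sumℕ-+ {zero}  f g = refl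
sumℕ-+ {suc n} f g = trans (cong (f Fin.zero ℕ.+ g Fin.zero ℕ.+_) (sumℕ-+ (f ∘ Fin.suc) (g ∘ Fin.suc)))
                           (+-interchange (f Fin.zero) (g Fin.zero) _ _)

sumℕ-zero : ∀ n → sumℕ {n} (λ _ → 0) ≡ 0
sumℕ-zero zero    = refl
sumℕ-zero (suc n) = sumℕ-zero n

sumℕ-one : ∀ n → sumℕ {n} (λ _ → 1) ≡ n
sumℕ-one zero    = refl
sumℕ-one (suc n) = cong suc (sumℕ-one n)

sumℕ-comm : ∀ {a b} (f : Fin a → Fin b → ℕ) →
            sumℕ (λ i → sumℕ (f i)) ≡ sumℕ (λ k → sumℕ (λ i → f i k))
sumℕ-comm {zero}  {b} f = ≡.sym (sumℕ-zero b)
sumℕ-comm {suc a}     f = trans (cong (sumℕ (f Fin.zero) ℕ.+_) (sumℕ-comm (f ∘ Fin.suc)))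
                                (≡.sym (sumℕ-+ (f Fin.zero) _))

sumℕ-mono : ∀ {n} {f g : Fin n → ℕ} → (∀ i → f i ≤ g i) → sumℕ f ≤ sumℕ g
sumℕ-mono {zero}  _   = z≤n
sumℕ-mono {suc n} f≤g = +-mono-≤ (f≤g Fin.zero) (sumℕ-mono (f≤g ∘ Fin.suc))

sumℕ-squeeze : ∀ {n} (f g : Fin n → ℕ) → (∀ i → f i ≤ g i) → sumℕ g ≤ sumℕ f → ∀ i → f i ≡ g i
sumℕ-squeeze {suc n} f g f≤g Σg≤Σf i with m≤n⇒m<n∨m≡n (f≤g Fin.zero)
... | inj₁ f₀<g₀ = ⊥-elim (<⇒≱ (+-mono-<-≤ f₀<g₀ (sumℕ-mono (f≤g ∘ Fin.suc))) Σg≤Σf)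
... | inj₂ f₀≡g₀ with i
...   | Fin.zero  = f₀≡g₀
...   | Fin.suc i = sumℕ-squeeze (f ∘ Fin.suc) (g ∘ Fin.suc) (f≤g ∘ Fin.suc)
                  (+-cancelˡ-≤ (g Fin.zero) _ _ (subst (λ x → g Fin.zero ℕ.+ _ ≤ x ℕ.+ _) f₀≡g₀ Σg≤Σf)) i

count-as-sumℕ : ∀ {n} (S : Subset n) → count S ≡ sumℕ (indℕ ∘ S)
count-as-sumℕ {zero}  S = refl
count-as-sumℕ {suc n} S = cong (indℕ (S Fin.zero) ℕ.+_) (count-as-sumℕ (S ∘ Fin.suc))

count-cong : ∀ {n} {S T : Subset n} → (∀ v → S v ≡ T v) → count S ≡ count T
count-cong {zero}  _   = refl
count-cong {suc n} S≗T = cong₂ ℕ._+_ (cong indℕ (S≗T Fin.zero)) (count-cong (S≗T ∘ Fin.suc))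

count-full : ∀ n → count (fullSet {n}) ≡ n
count-full zero    = refl
count-full (suc n) = cong suc (count-full n)

count-∪ : ∀ {n} (S T : Subset n) → (∀ v → v ∈ₛ S → T v ≡ false) → count (S ∪ₛ T) ≡ count S ℕ.+ count T
count-∪ {zero}  S T _        = refl
count-∪ {suc n} S T disjoint =
  trans (cong₂ ℕ._+_ (indℕ-∨ (S Fin.zero) (disjoint Fin.zero)) (count-∪ (S ∘ Fin.suc) (T ∘ Fin.suc) (disjoint ∘ Fin.suc)))
        (+-interchange (indℕ (S Fin.zero)) (indℕ (T Fin.zero)) _ _)
  where
  indℕ-∨ : ∀ a {b} → (a ≡ true → b ≡ false) → indℕ (a ∨ b) ≡ indℕ a ℕ.+ indℕ b
  indℕ-∨ true  a⇒¬b rewrite a⇒¬b refl = refl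
  indℕ-∨ false _    = refl

count-∖ : ∀ {n} (S : Subset n) {w} → w ∈ₛ S → count (S ∖ₛ w) ℕ.+ 1 ≡ count S
count-∖ {suc n} S {Fin.zero} w∈S
  rewrite ∧-zeroʳ (S Fin.zero) | w∈S | count-cong {S = λ v → S (Fin.suc v) ∧ true} (∧-identityʳ ∘ S ∘ Fin.suc) =
  ℕ.+-comm (count (S ∘ Fin.suc)) 1
count-∖ {suc n} S {Fin.suc w} w∈S =
  trans (ℕ.+-assoc (indℕ (S Fin.zero ∧ true)) _ 1)
        (cong₂ ℕ._+_ (cong indℕ (∧-identityʳ (S Fin.zero)))
                     (trans (cong (ℕ._+ 1) (count-cong λ v → cong (λ b → S (Fin.suc v) ∧ not b) (⌊suc≟suc⌋ v w)))
                            (count-∖ (S ∘ Fin.suc) w∈S)))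

sumℕ-count-comm : ∀ {a b} (R : Fin a → Subset b) →
                  sumℕ (λ j → count (λ k → R k j)) ≡ sumℕ (λ k → count (R k))
sumℕ-count-comm R = begin
  sumℕ (λ j → count (λ k → R k j))        ≡⟨ sumℕ-cong (λ j → count-as-sumℕ (λ k → R k j)) ⟩
  sumℕ (λ j → sumℕ (λ k → indℕ (R k j)))  ≡⟨ sumℕ-comm (λ j k → indℕ (R k j)) ⟩
  sumℕ (λ k → sumℕ (λ j → indℕ (R k j)))  ≡⟨ sumℕ-cong (λ k → ≡.sym (count-as-sumℕ (R k))) ⟩
  sumℕ (λ k → count (R k))                ∎
  where open ≡.≡-Reasoning

count-none : ∀ {n} (S : Subset n) → (∀ v → ¬ v ∈ₛ S) → count S ≡ 0
count-none {zero}  S _    = refl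
count-none {suc n} S none rewrite ¬-not (none Fin.zero) = count-none (S ∘ Fin.suc) (none ∘ Fin.suc)

count-≤1 : ∀ {n} (S : Subset n) → (∀ {u v} → u ∈ₛ S → v ∈ₛ S → u ≡ v) → count S ≤ 1
count-≤1 {zero}  S _ = z≤n
count-≤1 {suc n} S unique with S Fin.zero in 0∈S
... | true  = ≤-reflexive (cong suc (count-none (S ∘ Fin.suc) λ v v∈S → 0≢1+n (unique 0∈S v∈S)))
... | false = count-≤1 (S ∘ Fin.suc) λ u∈S v∈S → suc-injective (unique u∈S v∈S)

minimiser : ∀ {n} (S : Subset n) (f : Fin n → ℕ) →
            (∃ λ w → w ∈ₛ S × ∀ v → v ∈ₛ S → f w ≤ f v) ⊎ (∀ v → ¬ v ∈ₛ S)
minimiser {zero}  S f = inj₂ λ ()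
minimiser {suc n} S f with minimiser (S ∘ Fin.suc) (f ∘ Fin.suc) | S Fin.zero in 0∈S?
... | inj₂ none | false = inj₂ λ { Fin.zero 0∈S → true⇒≢false 0∈S 0∈S? ; (Fin.suc v) → none v }
... | inj₂ none | true  = inj₁ (Fin.zero , 0∈S? , λ { Fin.zero _ → ≤-refl ; (Fin.suc v) v∈S → ⊥-elim (none v v∈S) })
... | inj₁ (w , w∈S , w-min) | false =
  inj₁ (Fin.suc w , w∈S , λ { Fin.zero 0∈S → ⊥-elim (true⇒≢false 0∈S 0∈S?) ; (Fin.suc v) v∈S → w-min v v∈S })
... | inj₁ (w , w∈S , w-min) | true with f Fin.zero ≤? f (Fin.suc w)
...   | yes f₀≤ = inj₁ (Fin.zero , 0∈S? , λ { Fin.zero _ → ≤-refl ; (Fin.suc v) v∈S → ≤-trans f₀≤ (w-min v v∈S) })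
...   | no  f₀≰ = inj₁ (Fin.suc w , w∈S , λ { Fin.zero _ → <⇒≤ (≰⇒> f₀≰) ; (Fin.suc v) v∈S → w-min v v∈S })

module Geodesics {N : ℕ} (G : Graph N) (d : Fin N → Fin N → ℕ) (isD : IsDistance G d) where
  open Graph G
  open Walks G
  open Blocks G

  geodesic : ∀ u v → Walk G fullSet u v (d u v)
  geodesic u v = proj₁ (isD u v)

  d-minimal : ∀ {u v l} → Walk G fullSet u v l → d u v ≤ l
  d-minimal {u} {v} {l} = proj₂ (isD u v) l

  d-refl : ∀ u → d u u ≡ 0
  d-refl u = n≤0⇒n≡0 (d-minimal (here refl))

  d≡0⇒≡ : ∀ {u v} → d u v ≡ 0 → u ≡ v
  d≡0⇒≡ {u} {v} d≡0 with cast d≡0 (geodesic u v)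
  ... | here _ = refl

  d≡1⇒adj : ∀ {u v} → d u v ≡ 1 → adj u v ≡ true
  d≡1⇒adj {u} {v} d≡1 with cast d≡1 (geodesic u v)
  ... | step _ u~v (here _) = u~v

  adj⇒≢ : ∀ {u v} → adj u v ≡ true → u ≢ v
  adj⇒≢ {u} u~v refl = true⇒≢false u~v (irrefl u)

  adj⇒d≡1 : ∀ {u v} → adj u v ≡ true → d u v ≡ 1
  adj⇒d≡1 {u} {v} u~v with d u v in d≡ | d-minimal (step refl u~v (here refl))
  ... | 0             | _         = ⊥-elim (adj⇒≢ u~v (d≡0⇒≡ d≡))
  ... | 1             | _         = refl
  ... | suc (suc _)   | s≤s ()

  d-triangle : ∀ u v w → d u w ≤ d u v ℕ.+ d v w
  d-triangle u v w = d-minimal (geodesic u v ++ geodesic v w)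

  ∈ʷ⇒d+d≤length : ∀ {x y z l} (p : Walk G fullSet x y l) → z ∈ʷ p → d x z ℕ.+ d z y ≤ l
  ∈ʷ⇒d+d≤length p z∈p = subst (_ ≤_) length (+-mono-≤ (d-minimal prefix) (d-minimal suffix))
    where open Split (splitAt p z∈p)

  ∈ʷ⇒d≤length : ∀ {x y z l} (p : Walk G fullSet x y l) → z ∈ʷ p → d x z ≤ l
  ∈ʷ⇒d≤length p z∈p = ≤-trans (m≤m+n _ _) (∈ʷ⇒d+d≤length p z∈p)

  geodesic-avoids-farther : ∀ {u v w} → d u v < d u w → ¬ w ∈ʷ geodesic u v
  geodesic-avoids-farther d<d w∈ = <⇒≱ d<d (∈ʷ⇒d≤length (geodesic _ _) w∈)

  penultimate : ∀ {u v e} → d u v ≡ suc e →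
                ∃ λ c → Σ (Walk G fullSet u c e) λ p → adj c v ≡ true × ¬ v ∈ʷ p
  penultimate {u} {v} {e} d≡ with unsnoc (cast d≡ (geodesic u v))
  ... | c , p , c~v = c , p , c~v , λ v∈p → 1+n≰n (subst (_≤ e) d≡ (∈ʷ⇒d≤length p v∈p))

  module _ (i : Fin N) {S : Subset N} (blk : IsBlock G S) where

    detour-∈-block : ∀ {a b c l} → a ∈ₛ S → b ∈ₛ S → ¬ b ∈ʷ geodesic i a →
                     (p : Walk G fullSet i c l) → ¬ b ∈ʷ p → adj c b ≡ true → c ∈ₛ S
    detour-∈-block a∈S b∈S b∉geodesic p b∉p c~b =
      end-∈-block blk b∈S (reverse (geodesic i _) ++ p) a∈S
        (λ b∈ → [ b∉geodesic ∘ ∈ʷ-reverse⁻ _ , b∉p ] (∈ʷ-++⁻ _ p b∈)) c~b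

    nearest-∈-geodesic : ∀ {w} → w ∈ₛ S → (∀ l → l ∈ₛ S → d i w ≤ d i l) →
                         ∀ {l} → l ∈ₛ S → w ∈ʷ geodesic i l
    nearest-∈-geodesic {w} w∈S w-nearest {l} l∈S with w ∈ʷ? geodesic i l
    ... | yes w∈ = w∈
    ... | no  w∉ = ⊥-elim (closer (d i w) refl)
      where
      closer : ∀ e → d i w ≡ e → ⊥
      closer zero    d≡0 = w∉ (subst (_∈ʷ geodesic i l) (d≡0⇒≡ d≡0) (start-∈ʷ _))
      closer (suc e) d≡ with penultimate d≡
      ... | c , p , c~w , w∉p =
        1+n≰n (≤-trans (subst (_≤ d i c) d≡ (w-nearest c (detour-∈-block l∈S w∈S w∉ p w∉p c~w)))
                       (d-minimal p))

module BiBlock {N r : ℕ} (BG : BiBlockGraph N r) where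
  open BiBlockGraph BG renaming (sym to adj-sym)
  open Blocks graph

  record Sides (k : Fin r) (P Q : Subset N) : Set where
    field
      PQ-adj    : ∀ {u v} → u ∈ₛ P → v ∈ₛ Q → adj u v ≡ true
      PP-nonadj : ∀ {u v} → u ∈ₛ P → v ∈ₛ P → adj u v ≡ false
      QQ-nonadj : ∀ {u v} → u ∈ₛ Q → v ∈ₛ Q → adj u v ≡ false
      P-∉Q      : ∀ {v} → v ∈ₛ P → Q v ≡ false
      Bl≡P∪Q    : ∀ v → Bl k v ≡ (P ∪ₛ Q) v

    QP-adj : ∀ {u v} → u ∈ₛ Q → v ∈ₛ P → adj u v ≡ true
    QP-adj u∈Q v∈P = trans (adj-sym _ _) (PQ-adj v∈P u∈Q)

    P⊆Bl : ∀ {v} → v ∈ₛ P → v ∈ₛ Bl k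
    P⊆Bl {v} v∈P = trans (Bl≡P∪Q v) (∨-trueˡ _ v∈P)

    Q⊆Bl : ∀ {v} → v ∈ₛ Q → v ∈ₛ Bl k
    Q⊆Bl {v} v∈Q = trans (Bl≡P∪Q v) (∨-trueʳ (P v) v∈Q)

    Bl⊆P∪Q : ∀ {v} → v ∈ₛ Bl k → v ∈ₛ P ⊎ v ∈ₛ Q
    Bl⊆P∪Q {v} v∈Bl = ∨-true⁻ (P v) (trans (≡.sym (Bl≡P∪Q v)) v∈Bl)

    Q-inhabited : ∀ {u v} → u ∈ₛ P → v ∈ₛ P → u ≢ v → ∃ λ y → y ∈ₛ Q
    Q-inhabited {u} {v} u∈P v∈P u≢v = first-step (proj₂ (block-connected (blocks-are k) u v (P⊆Bl u∈P) (P⊆Bl v∈P)))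
      where
      first-step : ∀ {l} → Walk graph (Bl k) u v l → ∃ λ y → y ∈ₛ Q
      first-step (here _) = ⊥-elim (u≢v refl)
      first-step (step {w = y} _ u~y w) with Bl⊆P∪Q (Walks.∈ʷ⇒∈ₛ graph w (Walks.start-∈ʷ graph w))
      ... | inj₁ y∈P = ⊥-elim (true⇒≢false u~y (PP-nonadj u∈P y∈P))
      ... | inj₂ y∈Q = y , y∈Q

    adj-in-block : ∀ {j} → j ∈ₛ P → ∀ l → adj l j ∧ (Bl k l ∧ Bl k j) ≡ Q l
    adj-in-block {j} j∈P l rewrite P⊆Bl j∈P | Bl≡P∪Q l with P l in l∈P? | Q l in l∈Q?
    ... | true  | true  = ⊥-elim (true⇒≢false l∈Q? (P-∉Q l∈P?))
    ... | true  | false rewrite PP-nonadj l∈P? j∈P = refl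
    ... | false | true  rewrite QP-adj l∈Q? j∈P = refl
    ... | false | false = ∧-zeroʳ (adj l j)

  XY-sides : ∀ k → Sides k (X k) (Y k)
  XY-sides k = record
    { PQ-adj    = XY-adj k _ _
    ; PP-nonadj = XX-nonadj k _ _
    ; QQ-nonadj = YY-nonadj k _ _
    ; P-∉Q      = ¬-not ∘ disjoint k _
    ; Bl≡P∪Q    = λ _ → refl
    }

  Sides-swap : ∀ {k P Q} → Sides k P Q → Sides k Q P
  Sides-swap {P = P} {Q} sides = record
    { PQ-adj    = QP-adj
    ; PP-nonadj = QQ-nonadj
    ; QQ-nonadj = PP-nonadj
    ; P-∉Q      = λ v∈Q → ¬-not λ v∈P → true⇒≢false v∈Q (P-∉Q v∈P)
    ; Bl≡P∪Q    = λ v → trans (Bl≡P∪Q v) (∨-comm (P v) (Q v))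
    }
    where open Sides sides

  module Distances (d : Fin N → Fin N → ℕ) (isD : IsDistance graph d) where
    open Geodesics graph d isD

    module _ {k : Fin r} {P Q : Subset N} (sides : Sides k P Q) where
      open Sides sides

      d-across : ∀ {u v} → u ∈ₛ P → v ∈ₛ Q → d u v ≡ 1
      d-across u∈P v∈Q = adj⇒d≡1 (PQ-adj u∈P v∈Q)

      d-along : ∀ {u v} → u ∈ₛ P → v ∈ₛ P → u ≢ v → d u v ≡ 2
      d-along {u} {v} u∈P v∈P u≢v with Q-inhabited u∈P v∈P u≢v
      ... | y , y∈Q with d u v in d≡ | d-minimal (step refl (PQ-adj u∈P y∈Q) (step refl (QP-adj y∈Q v∈P) (here refl)))
      ...   | 0                 | _ = ⊥-elim (u≢v (d≡0⇒≡ d≡))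
      ...   | 1                 | _ = ⊥-elim (true⇒≢false (d≡1⇒adj d≡) (PP-nonadj u∈P v∈P))
      ...   | 2                 | _ = refl
      ...   | suc (suc (suc _)) | s≤s (s≤s ())

module Gates {N r : ℕ} (BG : BiBlockGraph N r) (d : Fin N → Fin N → ℕ)
             (isD : IsDistance (BiBlockGraph.graph BG) d) (i : Fin N) where
  open BiBlockGraph BG
  open Blocks graph
  open Geodesics graph d isD
  open BiBlock BG
  open Distances d isD

  private
    nearest : ∀ k → ∃ λ w → w ∈ₛ Bl k × ∀ l → l ∈ₛ Bl k → d i w ≤ d i l
    nearest k with minimiser (Bl k) (d i) | proj₁ (blocks-are k)
    ... | inj₁ w-nearest | _       = w-nearest
    ... | inj₂ none      | v , v∈  = ⊥-elim (none v v∈)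

  gate : Fin r → Fin N
  gate k = proj₁ (nearest k)

  gate-∈ : ∀ k → gate k ∈ₛ Bl k
  gate-∈ k = proj₁ (proj₂ (nearest k))

  d-via-gate : ∀ k {l} → l ∈ₛ Bl k → d i l ≡ d i (gate k) ℕ.+ d (gate k) l
  d-via-gate k {l} l∈ = ≤-antisym (d-triangle i (gate k) l)
    (∈ʷ⇒d+d≤length (geodesic i l) (nearest-∈-geodesic i (blocks-are k) (gate-∈ k) (proj₂ (proj₂ (nearest k))) l∈))

  module _ {k : Fin r} {P Q : Subset N} (sides : Sides k P Q) (g∈P : gate k ∈ₛ P) where
    open Sides sides

    d-across-gate : ∀ {l} → l ∈ₛ Q → d i l ≡ d i (gate k) ℕ.+ 1
    d-across-gate l∈Q = trans (d-via-gate k (Q⊆Bl l∈Q)) (cong (d i (gate k) ℕ.+_) (d-across sides g∈P l∈Q))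

    d-beside-gate : ∀ {l} → l ∈ₛ P → l ≢ gate k → d i l ≡ d i (gate k) ℕ.+ 2
    d-beside-gate l∈P l≢g =
      trans (d-via-gate k (P⊆Bl l∈P)) (cong (d i (gate k) ℕ.+_) (d-along sides g∈P l∈P (l≢g ∘ ≡.sym)))

  nonGate : Fin r → Subset N
  nonGate k = Bl k ∖ₛ gate k

  nonGate-at-gate : ∀ k → nonGate k (gate k) ≡ false
  nonGate-at-gate k = trans (cong (λ b → Bl k (gate k) ∧ not b) (isYes-true (gate k ≟ gate k) refl)) (∧-zeroʳ _)

  nonGate-farther : ∀ {k j} → j ∈ₛ nonGate k → d i (gate k) < d i j
  nonGate-farther {k} {j} j∈ rewrite d-via-gate k (∈-∖ₛ⁻ (Bl k) j∈) with d (gate k) j in d≡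
  ... | zero  = ⊥-elim (∈-∖ₛ⁻-≢ (Bl k) j∈ (≡.sym (d≡0⇒≡ d≡)))
  ... | suc e = m<m+n _ (s≤s z≤n)

  -- The vertex c preceding j on a geodesic from i lies in every block in which j is not the
  -- gate, since a detour through that gate reaches c avoiding j; two such blocks share the edge cj.
  nonGate-unique : ∀ {j k₁ k₂} → j ∈ₛ nonGate k₁ → j ∈ₛ nonGate k₂ → k₁ ≡ k₂
  nonGate-unique {j} {k₁} {k₂} j∈₁ j∈₂ with d i j in d≡
  ... | zero  = ⊥-elim (n≮0 (subst (d i (gate k₁) <_) d≡ (nonGate-farther j∈₁)))
  ... | suc e with penultimate d≡
  ...   | c , p , c~j , j∉p = blocks-distinct k₁ k₂ λ v →
            bool-ext (blocks-sharing-two-⊆ (blocks-are k₂) (blocks-are k₁) c≢j (c∈ j∈₂) j∈Bl₂ (c∈ j∈₁) j∈Bl₁ v)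
                     (blocks-sharing-two-⊆ (blocks-are k₁) (blocks-are k₂) c≢j (c∈ j∈₁) j∈Bl₁ (c∈ j∈₂) j∈Bl₂ v)
    where
    c≢j : c ≢ j
    c≢j = adj⇒≢ c~j

    j∈Bl₁ : j ∈ₛ Bl k₁
    j∈Bl₁ = ∈-∖ₛ⁻ (Bl k₁) j∈₁

    j∈Bl₂ : j ∈ₛ Bl k₂
    j∈Bl₂ = ∈-∖ₛ⁻ (Bl k₂) j∈₂

    c∈ : ∀ {k} → j ∈ₛ nonGate k → c ∈ₛ Bl k
    c∈ {k} j∈ = detour-∈-block i (blocks-are k) (gate-∈ k) (∈-∖ₛ⁻ (Bl k) j∈)
                  (geodesic-avoids-farther (nonGate-farther j∈)) p j∉p c~j

  nonGates : Fin N → ℕ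
  nonGates j = count (λ k → nonGate k j)

  nonGates-≤ : ∀ j → nonGates j ≤ indℕ (not ⌊ j ≟ i ⌋)
  nonGates-≤ j with j ≟ i
  ... | yes refl = ≤-reflexive (count-none _ λ k i∈ → n≮0 (subst (d i (gate k) <_) (d-refl i) (nonGate-farther i∈)))
  ... | no  _    = count-≤1 _ nonGate-unique

  -- Double counting: every block contributes all its vertices but the gate, and the
  -- hypothesis on N says that these numbers add up to N - 1, the number of vertices j ≠ i.
  nonGates≡ : N ≡ (sumℕ (λ k → m k ℕ.+ n k) ℕ.∸ r) ℕ.+ 1 → ∀ j → nonGates j ≡ indℕ (not ⌊ j ≟ i ⌋)
  nonGates≡ N≡ = sumℕ-squeeze nonGates _ nonGates-≤
    (≤-reflexive (+-cancelʳ-≡ 1 _ _ (trans others-total (≡.sym nonGates-total))))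
    where
    open ≡.≡-Reasoning

    block-size : ∀ k → count (nonGate k) ℕ.+ 1 ≡ m k ℕ.+ n k
    block-size k = trans (count-∖ (Bl k) (gate-∈ k)) (count-∪ (X k) (Y k) λ _ → Sides.P-∉Q (XY-sides k))

    nonGates-total : sumℕ nonGates ℕ.+ 1 ≡ N
    nonGates-total = begin
      sumℕ nonGates ℕ.+ 1                                         ≡⟨ cong (ℕ._+ 1) (sumℕ-count-comm nonGate) ⟩
      sumℕ (count ∘ nonGate) ℕ.+ 1                                ≡⟨ cong (ℕ._+ 1) (m+n∸n≡m _ r) ⟨
      sumℕ (count ∘ nonGate) ℕ.+ r ℕ.∸ r ℕ.+ 1                    ≡⟨ cong (λ x → x ℕ.∸ r ℕ.+ 1) blocks-total ⟩
      sumℕ (λ k → m k ℕ.+ n k) ℕ.∸ r ℕ.+ 1                        ≡⟨ N≡ ⟨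
      N                                                           ∎
      where
      blocks-total : sumℕ (count ∘ nonGate) ℕ.+ r ≡ sumℕ (λ k → m k ℕ.+ n k)
      blocks-total = begin
        sumℕ (count ∘ nonGate) ℕ.+ r                  ≡⟨ cong (sumℕ (count ∘ nonGate) ℕ.+_) (sumℕ-one r) ⟨
        sumℕ (count ∘ nonGate) ℕ.+ sumℕ {r} (λ _ → 1) ≡⟨ sumℕ-+ (count ∘ nonGate) (λ _ → 1) ⟨
        sumℕ (λ k → count (nonGate k) ℕ.+ 1)          ≡⟨ sumℕ-cong block-size ⟩
        sumℕ (λ k → m k ℕ.+ n k)                      ∎

    others-total : sumℕ (λ j → indℕ (not ⌊ j ≟ i ⌋)) ℕ.+ 1 ≡ N
    others-total = begin
      sumℕ (λ j → indℕ (not ⌊ j ≟ i ⌋)) ℕ.+ 1   ≡⟨ cong (ℕ._+ 1) (count-as-sumℕ (fullSet ∖ₛ i)) ⟨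
      count (fullSet ∖ₛ i) ℕ.+ 1               ≡⟨ count-∖ (fullSet {N}) {i} refl ⟩
      count (fullSet {N})                      ≡⟨ count-full N ⟩
      N                                        ∎

-- The ring solver for an arbitrary commutative ring, with integer coefficients: normal forms are
-- then compared by computation in ℤ.
module ℤ-Coefficients {c ℓ} (R : CommutativeRing c ℓ) where
  open import Data.Integer as ℤ using (ℤ; +_; -[1+_])
  import Data.Integer.Properties as ℤ
  open import Data.Maybe using (Maybe; just; nothing)
  open import Data.Sign as Sign using (Sign)
  open import Algebra.Solver.Ring.AlmostCommutativeRing
    using (fromCommutativeRing; _-Raw-AlmostCommutative⟶_)
  open CommutativeRing R renaming (refl to ≈-refl; sym to ≈-sym; trans to ≈-trans)
  open import Algebra.Properties.Ring ring using (-‿involutive; -0#≈0#; -‿+-comm; -1*x≈-x)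
  open import Algebra.Properties.AbelianGroup +-abelianGroup using (//-rightDividesʳ; xyx⁻¹≈y; ⁻¹-∙-comm)
  open import Algebra.Properties.Semiring.Mult.TCOptimised semiring using (×-homo-+; ×1-homo-*) renaming (_×_ to _×′_)
  open import Relation.Binary.Reasoning.Setoid setoid

  private
    -- The optimised multiplication _×′_ makes fromℤ (+ 1) reduce to 1#.
    fromℤ : ℤ → Carrier
    fromℤ (+ n)      = n ×′ 1#
    fromℤ -[1+ n ]   = - (ℕ.suc n ×′ 1#)

    signed : Sign → Carrier
    signed Sign.+ = 1#
    signed Sign.- = - 1#

    fromℤ-◃ : ∀ s n → fromℤ (s ℤ.◃ n) ≈ signed s * (n ×′ 1#)
    fromℤ-◃ _      ℕ.zero    = ≈-sym (zeroʳ _)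
    fromℤ-◃ Sign.+ (ℕ.suc n) = ≈-sym (*-identityˡ _)
    fromℤ-◃ Sign.- (ℕ.suc n) = ≈-sym (-1*x≈-x _)

    fromℤ-sign-abs : ∀ i → fromℤ i ≈ signed (ℤ.sign i) * (ℤ.∣ i ∣ ×′ 1#)
    fromℤ-sign-abs i = ≈-trans (reflexive (≡.cong fromℤ (≡.sym (ℤ.◃-inverse i)))) (fromℤ-◃ (ℤ.sign i) ℤ.∣ i ∣)

    signed-* : ∀ s t → signed (s Sign.* t) ≈ signed s * signed t
    signed-* Sign.+ t      = ≈-sym (*-identityˡ _)
    signed-* Sign.- Sign.+ = ≈-sym (*-identityʳ _)
    signed-* Sign.- Sign.- = ≈-sym (≈-trans (-1*x≈-x _) (-‿involutive 1#))

    fromℤ-neg : ∀ i → fromℤ (ℤ.- i) ≈ - fromℤ i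
    fromℤ-neg (+ ℕ.zero)  = ≈-sym -0#≈0#
    fromℤ-neg (+ ℕ.suc n) = ≈-refl
    fromℤ-neg -[1+ n ]    = ≈-sym (-‿involutive _)

    fromℤ-⊖ : ∀ m n → fromℤ (m ℤ.⊖ n) ≈ m ×′ 1# - n ×′ 1#
    fromℤ-⊖ m n with ℕ.≤-total n m
    ... | inj₁ n≤m = begin
      fromℤ (m ℤ.⊖ n)                          ≡⟨ ≡.cong fromℤ (ℤ.⊖-≥ n≤m) ⟩
      (m ℕ.∸ n) ×′ 1#                          ≈⟨ //-rightDividesʳ (n ×′ 1#) _ ⟨
      (m ℕ.∸ n) ×′ 1# + n ×′ 1# - n ×′ 1#      ≈⟨ +-congʳ (×-homo-+ 1# (m ℕ.∸ n) n) ⟨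
      (m ℕ.∸ n ℕ.+ n) ×′ 1# - n ×′ 1#          ≡⟨ ≡.cong (λ k → k ×′ 1# - n ×′ 1#) (ℕ.m∸n+n≡m n≤m) ⟩
      m ×′ 1# - n ×′ 1#                        ∎
    ... | inj₂ m≤n = begin
      fromℤ (m ℤ.⊖ n)                              ≡⟨ ≡.cong fromℤ (ℤ.⊖-≤ m≤n) ⟩
      fromℤ (ℤ.- (+ (n ℕ.∸ m)))                    ≈⟨ fromℤ-neg (+ (n ℕ.∸ m)) ⟩
      - ((n ℕ.∸ m) ×′ 1#)                          ≈⟨ xyx⁻¹≈y (m ×′ 1#) _ ⟨
      m ×′ 1# - (n ℕ.∸ m) ×′ 1# - m ×′ 1#          ≈⟨ +-assoc (m ×′ 1#) _ _ ⟩
      m ×′ 1# + (- ((n ℕ.∸ m) ×′ 1#) - m ×′ 1#)    ≈⟨ +-congˡ (⁻¹-∙-comm _ _) ⟩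
      m ×′ 1# - ((n ℕ.∸ m) ×′ 1# + m ×′ 1#)        ≈⟨ +-congˡ (-‿cong (×-homo-+ 1# (n ℕ.∸ m) m)) ⟨
      m ×′ 1# - (n ℕ.∸ m ℕ.+ m) ×′ 1#              ≡⟨ ≡.cong (λ k → m ×′ 1# - k ×′ 1#) (ℕ.m∸n+n≡m m≤n) ⟩
      m ×′ 1# - n ×′ 1#                            ∎

    fromℤ-+ : ∀ i j → fromℤ (i ℤ.+ j) ≈ fromℤ i + fromℤ j
    fromℤ-+ -[1+ m ] -[1+ n ] = begin
      - (ℕ.suc (ℕ.suc (m ℕ.+ n)) ×′ 1#)     ≡⟨ ≡.cong (λ k → - (ℕ.suc k ×′ 1#)) (ℕ.+-suc m n) ⟨
      - ((ℕ.suc m ℕ.+ ℕ.suc n) ×′ 1#)       ≈⟨ -‿cong (×-homo-+ 1# (ℕ.suc m) (ℕ.suc n)) ⟩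
      - (ℕ.suc m ×′ 1# + ℕ.suc n ×′ 1#)     ≈⟨ -‿+-comm _ _ ⟨
      fromℤ -[1+ m ] + fromℤ -[1+ n ]       ∎
    fromℤ-+ -[1+ m ] (+ n) = ≈-trans (fromℤ-⊖ n (ℕ.suc m)) (+-comm _ _)
    fromℤ-+ (+ m) -[1+ n ] = fromℤ-⊖ m (ℕ.suc n)
    fromℤ-+ (+ m) (+ n)    = ×-homo-+ 1# m n

    fromℤ-* : ∀ i j → fromℤ (i ℤ.* j) ≈ fromℤ i * fromℤ j
    fromℤ-* i j = begin
      fromℤ (i ℤ.* j)
        ≈⟨ fromℤ-◃ (ℤ.sign i Sign.* ℤ.sign j) (ℤ.∣ i ∣ ℕ.* ℤ.∣ j ∣) ⟩
      signed (ℤ.sign i Sign.* ℤ.sign j) * ((ℤ.∣ i ∣ ℕ.* ℤ.∣ j ∣) ×′ 1#)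
        ≈⟨ *-cong (signed-* (ℤ.sign i) (ℤ.sign j)) (×1-homo-* ℤ.∣ i ∣ ℤ.∣ j ∣) ⟩
      (signed (ℤ.sign i) * signed (ℤ.sign j)) * ((ℤ.∣ i ∣ ×′ 1#) * (ℤ.∣ j ∣ ×′ 1#))
        ≈⟨ interchange _ _ _ _ ⟩
      (signed (ℤ.sign i) * (ℤ.∣ i ∣ ×′ 1#)) * (signed (ℤ.sign j) * (ℤ.∣ j ∣ ×′ 1#))
        ≈⟨ *-cong (fromℤ-sign-abs i) (fromℤ-sign-abs j) ⟨
      fromℤ i * fromℤ j
        ∎
      where open import Algebra.Properties.CommutativeSemigroup *-commutativeSemigroup using (interchange)

    homomorphism : ℤ.+-*-rawRing -Raw-AlmostCommutative⟶ fromCommutativeRing R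
    homomorphism = record
      { ⟦_⟧    = fromℤ
      ; +-homo = fromℤ-+
      ; *-homo = fromℤ-*
      ; -‿homo = fromℤ-neg
      ; 0-homo = ≈-refl
      ; 1-homo = ≈-refl
      }

    fromℤ-≟ : ∀ i j → Maybe (fromℤ i ≈ fromℤ j)
    fromℤ-≟ i j with i ℤ.≟ j
    ... | yes ≡.refl = just ≈-refl
    ... | no  _      = nothing

  open import Algebra.Solver.Ring ℤ.+-*-rawRing (fromCommutativeRing R) homomorphism fromℤ-≟ public


module _ {c ℓ} (F : Field c ℓ) where
  open Field F renaming (refl to ≈-refl; sym to ≈-sym; trans to ≈-trans)
  open QData F
  open ℤ-Coefficients commutativeRing
  open import Algebra.Properties.Ring ring using (-0#≈0#; -‿+-comm)
  open import Algebra.Properties.Semiring.Mult semiring using (×-homo-+)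
  open import Algebra.Properties.Semiring.Sum semiring
    using (sum-cong-≋; ∑-distrib-+; ∑-comm; *-distribˡ-sum; sum-replicate-zero)
  open import Relation.Binary.Reasoning.Setoid setoid

  x-0#≈x : ∀ x → x - 0# ≈ x
  x-0#≈x x = ≈-trans (+-congˡ -0#≈0#) (+-identityʳ x)

  *-≉0 : ∀ {a b} → ¬ a ≈ 0# → ¬ b ≈ 0# → ¬ a * b ≈ 0#
  *-≉0 {a} {b} a≉0 b≉0 ab≈0 = b≉0 (begin
    b                ≈⟨ *-identityˡ b ⟨
    1# * b           ≈⟨ *-congʳ (≈-trans (*-comm _ _) (inverseʳ a a≉0)) ⟨
    a ⁻¹ * a * b     ≈⟨ *-assoc _ a b ⟩
    a ⁻¹ * (a * b)   ≈⟨ *-congˡ ab≈0 ⟩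
    a ⁻¹ * 0#        ≈⟨ zeroʳ _ ⟩
    0#               ∎)

  *-cancelʳ : ∀ {K x y} → ¬ K ≈ 0# → x * K ≈ y * K → x ≈ y
  *-cancelʳ {K} {x} {y} K≉0 xK≈yK = begin
    x                ≈⟨ *-identityʳ x ⟨
    x * 1#           ≈⟨ *-congˡ (inverseʳ K K≉0) ⟨
    x * (K * K ⁻¹)   ≈⟨ *-assoc x K (K ⁻¹) ⟨
    x * K * K ⁻¹     ≈⟨ *-congʳ xK≈yK ⟩
    y * K * K ⁻¹     ≈⟨ *-assoc y K (K ⁻¹) ⟩
    y * (K * K ⁻¹)   ≈⟨ *-congˡ (inverseʳ K K≉0) ⟩
    y * 1#           ≈⟨ *-identityʳ y ⟩
    y                ∎

  sum-cong : ∀ {n} {f g : Fin n → Carrier} → (∀ i → f i ≈ g i) → sum f ≈ sum g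
  sum-cong {f = f} {g} = sum-cong-≋ {x = f} {y = g}

  sum-*ˡ : ∀ {n} x (f : Fin n → Carrier) → sum (λ i → x * f i) ≈ x * sum f
  sum-*ˡ x f = ≈-sym (*-distribˡ-sum x f)

  sum-neg : ∀ {n} (f : Fin n → Carrier) → sum (λ i → - f i) ≈ - sum f
  sum-neg {zero}  f = ≈-sym -0#≈0#
  sum-neg {suc n} f = ≈-trans (+-congˡ (sum-neg (f ∘ Fin.suc))) (-‿+-comm _ _)

  sum-- : ∀ {n} (f g : Fin n → Carrier) → sum (λ i → f i - g i) ≈ sum f - sum g
  sum-- f g = ≈-trans (∑-distrib-+ f (λ i → - g i)) (+-congˡ (sum-neg g))

  sum-δ : ∀ {n} (j : Fin n) (g : Fin n → Carrier) → sum (λ l → ind ⌊ l ≟ j ⌋ * g l) ≈ g j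
  sum-δ {suc n} Fin.zero g = begin
    1# * g Fin.zero + sum (λ l → 0# * g (Fin.suc l))  ≈⟨ +-cong (*-identityˡ _) (sum-cong {n} (λ l → zeroˡ _)) ⟩
    g Fin.zero + sum {n} (λ _ → 0#)                  ≈⟨ +-congˡ (sum-replicate-zero n) ⟩
    g Fin.zero + 0#                                   ≈⟨ +-identityʳ _ ⟩
    g Fin.zero                                        ∎
  sum-δ {suc n} (Fin.suc j) g = begin
    0# * g Fin.zero + sum (λ l → ind ⌊ Fin.suc l ≟ Fin.suc j ⌋ * g (Fin.suc l))
      ≈⟨ +-cong (zeroˡ _) (sum-cong λ l → reflexive (≡.cong (λ b → ind b * g (Fin.suc l)) (⌊suc≟suc⌋ l j))) ⟩
    0# + sum (λ l → ind ⌊ l ≟ j ⌋ * g (Fin.suc l))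
      ≈⟨ +-identityˡ _ ⟩
    sum (λ l → ind ⌊ l ≟ j ⌋ * g (Fin.suc l))
      ≈⟨ sum-δ j (g ∘ Fin.suc) ⟩
    g (Fin.suc j)
      ∎

  ι-indℕ : ∀ b → ι (indℕ b) ≈ ind b
  ι-indℕ true  = +-identityʳ 1#
  ι-indℕ false = ≈-refl

  sum-ind : ∀ {n} (S : Subset n) x → sum (λ l → ind (S l) * x) ≈ ι (count S) * x
  sum-ind {zero}  S x = ≈-sym (zeroˡ x)
  sum-ind {suc n} S x = begin
    ind (S Fin.zero) * x + sum (λ l → ind (S (Fin.suc l)) * x)   ≈⟨ +-congˡ (sum-ind (S ∘ Fin.suc) x) ⟩
    ind (S Fin.zero) * x + ι (count (S ∘ Fin.suc)) * x           ≈⟨ distribʳ x _ _ ⟨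
    (ind (S Fin.zero) + ι (count (S ∘ Fin.suc))) * x             ≈⟨ *-congʳ (+-congʳ (ι-indℕ (S Fin.zero))) ⟨
    (ι (indℕ (S Fin.zero)) + ι (count (S ∘ Fin.suc))) * x        ≈⟨ *-congʳ (×-homo-+ 1# (indℕ (S Fin.zero)) _) ⟨
    ι (count S) * x                                              ∎

  sum-ind-const : ∀ {n} (S : Subset n) {f : Fin n → Carrier} {x} → (∀ l → l ∈ₛ S → f l ≈ x) →
                  sum (λ l → ind (S l) * f l) ≈ ι (count S) * x
  sum-ind-const S {f} {x} f≈x = ≈-trans (sum-cong pointwise) (sum-ind S x)
    where
    pointwise : ∀ l → ind (S l) * f l ≈ ind (S l) * x
    pointwise l with S l in l∈S?
    ... | true  = *-congˡ (f≈x l l∈S?)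
    ... | false = ≈-trans (zeroˡ _) (≈-sym (zeroˡ _))

  sum-ind-but-one : ∀ {n} (S : Subset n) {f : Fin n → Carrier} {w x} → w ∈ₛ S →
                    (∀ l → l ∈ₛ S → l ≢ w → f l ≈ x) →
                    sum (λ l → ind (S l) * f l) ≈ ι (count S) * x + (f w - x)
  sum-ind-but-one S {f} {w} {x} w∈S f≈x = begin
    sum (λ l → ind (S l) * f l)
      ≈⟨ sum-cong pointwise ⟩
    sum (λ l → ind (S l) * x + ind ⌊ l ≟ w ⌋ * (f w - x))
      ≈⟨ ∑-distrib-+ (λ l → ind (S l) * x) _ ⟩
    sum (λ l → ind (S l) * x) + sum (λ l → ind ⌊ l ≟ w ⌋ * (f w - x))
      ≈⟨ +-cong (sum-ind S x) (sum-δ w (λ _ → f w - x)) ⟩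
    ι (count S) * x + (f w - x)
      ∎
    where
    pointwise : ∀ l → ind (S l) * f l ≈ ind (S l) * x + ind ⌊ l ≟ w ⌋ * (f w - x)
    pointwise l with l ≟ w
    ... | yes ≡.refl rewrite w∈S = solve 2 (λ y x → con (+ 1) :* y := con (+ 1) :* x :+ con (+ 1) :* (y :- x)) ≈-refl (f l) x
    ... | no  l≢w with S l in l∈S?
    ...   | true  = ≈-trans (*-congˡ (f≈x l l∈S? l≢w)) (solve 2 (λ a b → a := a :+ con (+ 0) :* b) ≈-refl _ _)
    ...   | false = solve 3 (λ a b c → con (+ 0) :* a := con (+ 0) :* b :+ con (+ 0) :* (c :- b)) ≈-refl (f l) x (f w)

  sum-*-combination : ∀ {n} α β γ (f g h e : Fin n → Carrier) →
    sum (λ l → f l * (α * g l - β * h l + γ * e l))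
      ≈ α * sum (λ l → g l * f l) - β * sum (λ l → h l * f l) + γ * sum (λ l → e l * f l)
  sum-*-combination {n} α β γ f g h e = begin
    sum (λ l → f l * (α * g l - β * h l + γ * e l))
      ≈⟨ sum-cong {n} (λ l → solve 7 (λ α β γ f g h e → f :* (α :* g :- β :* h :+ γ :* e)
                                   := α :* (g :* f) :- β :* (h :* f) :+ γ :* (e :* f)) ≈-refl α β γ (f l) (g l) (h l) (e l)) ⟩
    sum (λ l → α * (g l * f l) - β * (h l * f l) + γ * (e l * f l))
      ≈⟨ ∑-distrib-+ {n} (λ l → α * (g l * f l) - β * (h l * f l)) _ ⟩
    sum (λ l → α * (g l * f l) - β * (h l * f l)) + sum (λ l → γ * (e l * f l))
      ≈⟨ +-cong (sum-- {n} (λ l → α * (g l * f l)) _) (sum-*ˡ {n} γ _) ⟩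
    sum (λ l → α * (g l * f l)) - sum (λ l → β * (h l * f l)) + γ * sum (λ l → e l * f l)
      ≈⟨ +-congʳ (+-cong (sum-*ˡ {n} α _) (-‿cong (sum-*ˡ {n} β _))) ⟩
    α * sum (λ l → g l * f l) - β * sum (λ l → h l * f l) + γ * sum (λ l → e l * f l)
      ∎

  ind-∖ : ∀ {n} (S : Subset n) {j} → j ∈ₛ S →
          ∀ l → ind (not ⌊ l ≟ j ⌋ ∧ S l ∧ S j) ≈ ind (S l) - ind ⌊ l ≟ j ⌋
  ind-∖ S {j} j∈S l with l ≟ j
  ... | yes ≡.refl rewrite j∈S = ≈-sym (-‿inverseʳ 1#)
  ... | no  _      rewrite j∈S | ∧-identityʳ (S l) = ≈-sym (x-0#≈x _)

  ind-∉ : ∀ {n} (S : Subset n) {j} → S j ≡ false → ∀ l → ind (not ⌊ l ≟ j ⌋ ∧ S l ∧ S j) ≈ 0#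
  ind-∉ S {j} j∉S l rewrite j∉S | ∧-zeroʳ (S l) | ∧-zeroʳ (not ⌊ l ≟ j ⌋) = ≈-refl

  ind-δ-cong : ∀ {n} {j} (f : Fin n → Carrier) l → ind ⌊ l ≟ j ⌋ * f l ≈ ind ⌊ l ≟ j ⌋ * f j
  ind-δ-cong {j = j} f l with l ≟ j
  ... | yes ≡.refl = ≈-refl
  ... | no  _      = ≈-trans (zeroˡ _) (≈-sym (zeroˡ _))

  module _ (q : Carrier) where
    E₁ E₂ : Carrier → Carrier
    E₁ t = 1# + q * t
    E₂ t = 1# + q + q * q * t

    qnum-suc : ∀ e → qnum q (suc e) ≈ 1# + q * qnum q e
    qnum-suc zero    = solve 1 (λ q → con (+ 0) :+ con (+ 1) := con (+ 1) :+ q :* con (+ 0)) ≈-refl q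
    qnum-suc (suc e) = begin
      qnum q (suc e) + q ^ suc e           ≈⟨ +-congʳ (qnum-suc e) ⟩
      1# + q * qnum q e + q * q ^ e        ≈⟨ solve 3 (λ q t p → con (+ 1) :+ q :* t :+ q :* p
                                                            := con (+ 1) :+ q :* (t :+ p)) ≈-refl q _ _ ⟩
      1# + q * (qnum q e + q ^ e)          ∎

    qnum-+1 : ∀ e → qnum q (e ℕ.+ 1) ≈ E₁ (qnum q e)
    qnum-+1 e rewrite ℕ.+-comm e 1 = qnum-suc e

    qnum-+2 : ∀ e → qnum q (e ℕ.+ 2) ≈ E₂ (qnum q e)
    qnum-+2 e rewrite ℕ.+-comm e 2 = begin
      qnum q (suc (suc e))            ≈⟨ qnum-suc (suc e) ⟩
      1# + q * qnum q (suc e)         ≈⟨ +-congˡ (*-congˡ (qnum-suc e)) ⟩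
      1# + q * (1# + q * qnum q e)    ≈⟨ solve 2 (λ q t → con (+ 1) :+ q :* (con (+ 1) :+ q :* t)
                                                     := con (+ 1) :+ q :+ q :* q :* t) ≈-refl q _ ⟩
      1# + q + q * q * qnum q e       ∎

    ^≈1+[q-1]qnum : ∀ e → q ^ e ≈ 1# + (q - 1#) * qnum q e
    ^≈1+[q-1]qnum zero    = solve 1 (λ q → con (+ 1) := con (+ 1) :+ (q :- con (+ 1)) :* con (+ 0)) ≈-refl q
    ^≈1+[q-1]qnum (suc e) = begin
      q * q ^ e                                   ≈⟨ *-congˡ (^≈1+[q-1]qnum e) ⟩
      q * (1# + (q - 1#) * qnum q e)              ≈⟨ solve 2 (λ q t → q :* (con (+ 1) :+ (q :- con (+ 1)) :* t)
                                                        := con (+ 1) :+ (q :- con (+ 1)) :* (con (+ 1) :+ q :* t)) ≈-refl q _ ⟩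
      1# + (q - 1#) * (1# + q * qnum q e)         ≈⟨ +-congˡ (*-congˡ (qnum-suc e)) ⟨
      1# + (q - 1#) * qnum q (suc e)              ∎

    ^-+1 : ∀ e → q ^ (e ℕ.+ 1) ≈ q * (1# + (q - 1#) * qnum q e)
    ^-+1 e rewrite ℕ.+-comm e 1 = *-congˡ (^≈1+[q-1]qnum e)

    ^-+2 : ∀ e → q ^ (e ℕ.+ 2) ≈ q * q * (1# + (q - 1#) * qnum q e)
    ^-+2 e rewrite ℕ.+-comm e 2 = ≈-trans (*-congˡ (*-congˡ (^≈1+[q-1]qnum e))) (≈-sym (*-assoc q q _))

    c₁ c₂ c₃ : Carrier
    c₁ = q / (q + 1#)
    c₂ = (q * q) / (q + 1#)
    c₃ = 1# / (q + 1#)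

    c₃-c₂≈1-q : ¬ q + 1# ≈ 0# → c₃ - c₂ ≈ 1# - q
    c₃-c₂≈1-q q+1≉0 = begin
      c₃ - c₂                                    ≈⟨ solve 2 (λ q u → con (+ 1) :* u :- q :* q :* u
                                                        := (con (+ 1) :- q) :* (u :* (q :+ con (+ 1)))) ≈-refl q _ ⟩
      (1# - q) * ((q + 1#) ⁻¹ * (q + 1#))        ≈⟨ *-congˡ (≈-trans (*-comm _ _) (inverseʳ _ q+1≉0)) ⟩
      (1# - q) * 1#                              ≈⟨ *-identityʳ _ ⟩
      1# - q                                     ∎

    -- The contribution of one block to an entry of 𝓓𝓛, in terms of the sums SP, SQ of the
    -- q-distances over the side P containing j and the opposite side Q (with |P| = a, |Q| = b),
    -- and of the q-distance Fj of j itself.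
    module BlockAlgebra (a b Δ : Carrier) (q+1≉0 : ¬ q + 1# ≈ 0#) (Δ≉0 : ¬ Δ ≈ 0#)
                        (Δ≈ : Δ ≈ q * q * (a - 1#) * (b - 1#) - 1#) where
      contribution : Carrier → Carrier → Carrier → Carrier
      contribution SP SQ Fj = c₁ * (1# / Δ) * SQ - c₂ * ((b - 1#) / Δ) * SP + c₂ * Fj

      xEntry : Carrier
      xEntry = (q * (b - 1#) - 1#) / ((q + 1#) * Δ) - 1#

      contribution-cong : ∀ {SP SP′ SQ SQ′ Fj Fj′} → SP ≈ SP′ → SQ ≈ SQ′ → Fj ≈ Fj′ →
                          contribution SP SQ Fj ≈ contribution SP′ SQ′ Fj′
      contribution-cong SP≈ SQ≈ Fj≈ = +-cong (+-cong (*-congˡ SQ≈) (-‿cong (*-congˡ SP≈))) (*-congˡ Fj≈)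

      private
        K : Carrier
        K = (q + 1#) * Δ

        K≉0 : ¬ K ≈ 0#
        K≉0 = *-≉0 q+1≉0 Δ≉0

        u≈1 : (q + 1#) ⁻¹ * (q + 1#) ≈ 1#
        u≈1 = ≈-trans (*-comm _ _) (inverseʳ _ q+1≉0)

        v≈1 : Δ ⁻¹ * Δ ≈ 1#
        v≈1 = ≈-trans (*-comm _ _) (inverseʳ _ Δ≉0)

        contribution*K : ∀ SP SQ Fj → contribution SP SQ Fj * K ≈ q * SQ - q * q * (b - 1#) * SP + q * q * Δ * Fj
        contribution*K SP SQ Fj = begin
          contribution SP SQ Fj * K
            ≈⟨ solve 8 (λ q u v b SP SQ Fj Δ →
                 ((q :* u) :* (con (+ 1) :* v) :* SQ :- (q :* q :* u) :* ((b :- con (+ 1)) :* v) :* SP :+ (q :* q :* u) :* Fj)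
                   :* ((q :+ con (+ 1)) :* Δ)
                 := (q :* SQ :- q :* q :* (b :- con (+ 1)) :* SP) :* (u :* (q :+ con (+ 1))) :* (v :* Δ)
                    :+ q :* q :* Δ :* Fj :* (u :* (q :+ con (+ 1))))
                 ≈-refl q ((q + 1#) ⁻¹) (Δ ⁻¹) b SP SQ Fj Δ ⟩
          (q * SQ - q * q * (b - 1#) * SP) * ((q + 1#) ⁻¹ * (q + 1#)) * (Δ ⁻¹ * Δ) + q * q * Δ * Fj * ((q + 1#) ⁻¹ * (q + 1#))
            ≈⟨ +-cong (*-cong (*-congˡ u≈1) v≈1) (*-congˡ u≈1) ⟩
          (q * SQ - q * q * (b - 1#) * SP) * 1# * 1# + q * q * Δ * Fj * 1#
            ≈⟨ +-cong (≈-trans (*-identityʳ _) (*-identityʳ _)) (*-identityʳ _) ⟩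
          q * SQ - q * q * (b - 1#) * SP + q * q * Δ * Fj
            ∎

        [xEntry+T]*K : ∀ T → (xEntry + T) * K ≈ q * (b - 1#) - 1# + (T - 1#) * K
        [xEntry+T]*K T = begin
          (xEntry + T) * K
            ≈⟨ solve 4 (λ c w T K → (c :* w :- con (+ 1) :+ T) :* K := c :* (w :* K) :+ (T :- con (+ 1)) :* K)
                 ≈-refl (q * (b - 1#) - 1#) (K ⁻¹) T K ⟩
          (q * (b - 1#) - 1#) * (K ⁻¹ * K) + (T - 1#) * K
            ≈⟨ +-congʳ (≈-trans (*-congˡ (≈-trans (*-comm _ _) (inverseʳ K K≉0))) (*-identityʳ _)) ⟩
          q * (b - 1#) - 1# + (T - 1#) * K
            ∎

        -- Clearing the denominators (q + 1)Δ reduces each case to a polynomial identity in q, a, b.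
        cleared : ∀ SP SQ Fj T →
                  q * SQ - q * q * (b - 1#) * SP + q * q * (q * q * (a - 1#) * (b - 1#) - 1#) * Fj
                    ≈ q * (b - 1#) - 1# + (T - 1#) * ((q + 1#) * (q * q * (a - 1#) * (b - 1#) - 1#)) →
                  contribution SP SQ Fj ≈ xEntry + T
        cleared SP SQ Fj T identity = *-cancelʳ K≉0 (begin
          contribution SP SQ Fj * K                          ≈⟨ contribution*K SP SQ Fj ⟩
          q * SQ - q * q * (b - 1#) * SP + q * q * Δ * Fj    ≈⟨ +-congˡ (*-congʳ (*-congˡ Δ≈)) ⟩
          _                                                  ≈⟨ identity ⟩
          _                                                  ≈⟨ +-congˡ (*-congˡ (*-congˡ Δ≈)) ⟨
          q * (b - 1#) - 1# + (T - 1#) * K                   ≈⟨ [xEntry+T]*K T ⟨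
          (xEntry + T) * K                                   ∎)

        one : ∀ {n} → Polynomial n
        one = con (+ 1)

        Δᴾ : ∀ {n} → Polynomial n → Polynomial n → Polynomial n → Polynomial n
        Δᴾ q a b = q :* q :* (a :- one) :* (b :- one) :- one

        E₁ᴾ E₂ᴾ : ∀ {n} → Polynomial n → Polynomial n → Polynomial n
        E₁ᴾ q t = one :+ q :* t
        E₂ᴾ q t = one :+ q :+ q :* q :* t

        clearedᴾ : ∀ {n} (q a b SP SQ Fj T : Polynomial n) → Polynomial n × Polynomial n
        clearedᴾ q a b SP SQ Fj T =
          q :* SQ :- q :* q :* (b :- one) :* SP :+ q :* q :* Δᴾ q a b :* Fj
            := q :* (b :- one) :- one :+ (T :- one) :* ((q :+ one) :* Δᴾ q a b)

      at-gate : ∀ t → contribution (a * E₂ t + (t - E₂ t)) (b * E₁ t) t ≈ xEntry + 0#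
      at-gate t = cleared _ _ _ _ (solve 4 (λ q a b t →
        clearedᴾ q a b (a :* E₂ᴾ q t :+ (t :- E₂ᴾ q t)) (b :* E₁ᴾ q t) t (con (+ 0))) ≈-refl q a b t)

      beside-gate : ∀ t → contribution (a * E₂ t + (t - E₂ t)) (b * E₁ t) (E₂ t) ≈ xEntry + q * q * (1# + (q - 1#) * t)
      beside-gate t = cleared _ _ _ _ (solve 4 (λ q a b t →
        clearedᴾ q a b (a :* E₂ᴾ q t :+ (t :- E₂ᴾ q t)) (b :* E₁ᴾ q t) (E₂ᴾ q t) (q :* q :* (one :+ (q :- one) :* t)))
        ≈-refl q a b t)

      across-gate : ∀ t → contribution (a * E₁ t) (b * E₂ t + (t - E₂ t)) (E₁ t) ≈ xEntry + q * (1# + (q - 1#) * t)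
      across-gate t = cleared _ _ _ _ (solve 4 (λ q a b t →
        clearedᴾ q a b (a :* E₁ᴾ q t) (b :* E₂ᴾ q t :+ (t :- E₂ᴾ q t)) (E₁ᴾ q t) (q :* (one :+ (q :- one) :* t)))
        ≈-refl q a b t)

    module Column {N r : ℕ} (G : BiBlockGraph N r) (q+1≉0 : ¬ q + 1# ≈ 0#)
                  (Δ≉1 : ∀ k → ¬ q * q * (ι (BiBlockGraph.m G k) - 1#) * (ι (BiBlockGraph.n G k) - 1#) ≈ 1#)
                  (d : Fin N → Fin N → ℕ) (isD : IsDistance (BiBlockGraph.graph G) d) (i : Fin N) where
      open BiBlockGraph G using (X; Y; Bl; m; n; adj; graph; disjoint)
      open BiBlock G using (Sides; XY-sides; Sides-swap)
      open Gates G d isD i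
      open Geodesics graph d isD using (d-refl)

      Δ≉0 : ∀ k → ¬ Δ G q k ≈ 0#
      Δ≉0 k Δ≈0 = Δ≉1 k (begin
        q * q * (ι (m k) - 1#) * (ι (n k) - 1#)   ≈⟨ solve 2 (λ x y → x := x :- y :+ y) ≈-refl _ 1# ⟩
        Δ G q k + 1#                             ≈⟨ +-congʳ Δ≈0 ⟩
        0# + 1#                                  ≈⟨ +-identityˡ 1# ⟩
        1#                                       ∎)

      qd : Fin N → Carrier
      qd l = qnum q (d i l)

      nX nY xX xY : Fin r → Carrier
      nX k = (ι (n k) - 1#) / Δ G q k
      nY k = (ι (m k) - 1#) / Δ G q k
      xX k = (q * (ι (n k) - 1#) - 1#) / ((q + 1#) * Δ G q k)
      xY k = (q * (ι (m k) - 1#) - 1#) / ((q + 1#) * Δ G q k)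

      -- The k-th block's share of y(v) and of x(v), including its term of d̂(v).
      bySide : Fin r → Fin N → Carrier → Carrier → Carrier
      bySide k v s t = ind (X k v) * s + ind (Y k v) * t - ind (Bl k v)

      module _ {k : Fin r} {v : Fin N} {s t : Carrier} where
        bySide-X : X k v ≡ true → Y k v ≡ false → bySide k v s t ≈ s - 1#
        bySide-X v∈X v∉Y rewrite v∈X | v∉Y =
          solve 2 (λ s t → con (+ 1) :* s :+ con (+ 0) :* t :- con (+ 1) := s :- con (+ 1)) ≈-refl s t

        bySide-Y : X k v ≡ false → Y k v ≡ true → bySide k v s t ≈ t - 1#
        bySide-Y v∉X v∈Y rewrite v∉X | v∈Y =
          solve 2 (λ s t → con (+ 0) :* s :+ con (+ 1) :* t :- con (+ 1) := t :- con (+ 1)) ≈-refl s t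

        bySide-out : X k v ≡ false → Y k v ≡ false → bySide k v s t ≈ 0#
        bySide-out v∉X v∉Y rewrite v∉X | v∉Y =
          solve 2 (λ s t → con (+ 0) :* s :+ con (+ 0) :* t :- con (+ 0) := con (+ 0)) ≈-refl s t

      sum-bySide : ∀ v (s t : Fin r → Carrier) →
                   sum (λ k → ind (X k v) * s k) + sum (λ k → ind (Y k v) * t k) - (dhat G q v - 1#)
                     ≈ sum (λ k → bySide k v (s k) (t k)) + 1#
      sum-bySide v s t = begin
        Σs + Σt - (dhat G q v - 1#)                  ≈⟨ solve 3 (λ a b e → a :+ b :- (e :- con (+ 1)) := a :+ b :- e :+ con (+ 1))
                                                           ≈-refl Σs Σt (dhat G q v) ⟩
        Σs + Σt - dhat G q v + 1#                    ≈⟨ +-congʳ (+-congʳ (∑-distrib-+ {r} (λ k → ind (X k v) * s k) _)) ⟨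
        sum (λ k → ind (X k v) * s k + ind (Y k v) * t k) - dhat G q v + 1#
                                                     ≈⟨ +-congʳ (sum-- {r} (λ k → ind (X k v) * s k + ind (Y k v) * t k) _) ⟨
        sum (λ k → bySide k v (s k) (t k)) + 1#      ∎
        where
        Σs Σt : Carrier
        Σs = sum (λ k → ind (X k v) * s k)
        Σt = sum (λ k → ind (Y k v) * t k)

      𝓛ₖ : Fin r → Fin N → Fin N → Carrier
      𝓛ₖ k l j = c₁ * (ind (adj l j ∧ Bl k l ∧ Bl k j) * (1# / Δ G q k))
              - c₂ * (ind (not ⌊ l ≟ j ⌋ ∧ X k l ∧ X k j) * nX k + ind (not ⌊ l ≟ j ⌋ ∧ Y k l ∧ Y k j) * nY k)
              - c₂ * (ind ⌊ l ≟ j ⌋ * bySide k l (nX k) (nY k))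

      𝓛-by-blocks : ∀ l j → 𝓛 G q l j ≈ sum (λ k → 𝓛ₖ k l j) + (1# - q) * ind ⌊ l ≟ j ⌋
      𝓛-by-blocks l j = begin
        𝓛 G q l j
          ≡⟨⟩
        c₁ * Amat G q l j - c₂ * Bmat G q l j - c₂ * (δ * yvec G q l) + c₃ * δ
          ≈⟨ +-congʳ (+-congˡ (-‿cong (*-congˡ (*-congˡ (sum-bySide l nX nY))))) ⟩
        c₁ * Amat G q l j - c₂ * Bmat G q l j - c₂ * (δ * (Σy + 1#)) + c₃ * δ
          ≈⟨ solve 7 (λ c₁ A c₂ B δ y c₃ → c₁ :* A :- c₂ :* B :- c₂ :* (δ :* (y :+ con (+ 1))) :+ c₃ :* δ
                                         := c₁ :* A :- c₂ :* B :- c₂ :* (δ :* y) :+ (c₃ :- c₂) :* δ)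
               ≈-refl c₁ (Amat G q l j) c₂ (Bmat G q l j) δ Σy c₃ ⟩
        c₁ * Amat G q l j - c₂ * Bmat G q l j - c₂ * (δ * Σy) + (c₃ - c₂) * δ
          ≈⟨ +-cong (≈-sym sum-𝓛ₖ) (*-congʳ (c₃-c₂≈1-q q+1≉0)) ⟩
        sum (λ k → 𝓛ₖ k l j) + (1# - q) * δ
          ∎
        where
        δ Σy : Carrier
        δ  = ind ⌊ l ≟ j ⌋
        Σy = sum (λ k → bySide k l (nX k) (nY k))

        sum-𝓛ₖ : sum (λ k → 𝓛ₖ k l j) ≈ c₁ * Amat G q l j - c₂ * Bmat G q l j - c₂ * (δ * Σy)
        sum-𝓛ₖ = begin
          sum (λ k → 𝓛ₖ k l j)
            ≈⟨ sum-- {r} (λ k → c₁ * a k - c₂ * b k) _ ⟩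
          sum (λ k → c₁ * a k - c₂ * b k) - sum (λ k → c₂ * (δ * y k))
            ≈⟨ +-cong (sum-- {r} (λ k → c₁ * a k) _) (-‿cong (≈-trans (sum-*ˡ {r} c₂ _) (*-congˡ (sum-*ˡ {r} δ y)))) ⟩
          sum (λ k → c₁ * a k) - sum (λ k → c₂ * b k) - c₂ * (δ * Σy)
            ≈⟨ +-congʳ (+-cong (sum-*ˡ {r} c₁ a) (-‿cong (sum-*ˡ {r} c₂ b))) ⟩
          c₁ * Amat G q l j - c₂ * Bmat G q l j - c₂ * (δ * Σy)
            ∎
          where
          a b y : Fin r → Carrier
          a k = ind (adj l j ∧ Bl k l ∧ Bl k j) * (1# / Δ G q k)
          b k = ind (not ⌊ l ≟ j ⌋ ∧ X k l ∧ X k j) * nX k + ind (not ⌊ l ≟ j ⌋ ∧ Y k l ∧ Y k j) * nY k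
          y k = bySide k l (nX k) (nY k)

      row-by-blocks : ∀ j → sum (λ l → qd l * 𝓛 G q l j) ≈ sum (λ k → sum (λ l → qd l * 𝓛ₖ k l j)) + (1# - q) * qd j
      row-by-blocks j = begin
        sum (λ l → qd l * 𝓛 G q l j)
          ≈⟨ sum-cong {N} (λ l → *-congˡ (𝓛-by-blocks l j)) ⟩
        sum (λ l → qd l * (sum (λ k → 𝓛ₖ k l j) + (1# - q) * ind ⌊ l ≟ j ⌋))
          ≈⟨ sum-cong {N} (λ l → ≈-trans (distribˡ _ _ _) (+-cong (≈-sym (sum-*ˡ {r} (qd l) _)) (*-comm-assoc l))) ⟩
        sum (λ l → sum (λ k → qd l * 𝓛ₖ k l j) + (1# - q) * (ind ⌊ l ≟ j ⌋ * qd l))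
          ≈⟨ ∑-distrib-+ {N} (λ l → sum (λ k → qd l * 𝓛ₖ k l j)) _ ⟩
        sum (λ l → sum (λ k → qd l * 𝓛ₖ k l j)) + sum (λ l → (1# - q) * (ind ⌊ l ≟ j ⌋ * qd l))
          ≈⟨ +-cong (∑-comm {N} {r} (λ l k → qd l * 𝓛ₖ k l j))
                    (≈-trans (sum-*ˡ {N} (1# - q) _) (*-congˡ (sum-δ j qd))) ⟩
        sum (λ k → sum (λ l → qd l * 𝓛ₖ k l j)) + (1# - q) * qd j
          ∎
        where
        *-comm-assoc : ∀ l → qd l * ((1# - q) * ind ⌊ l ≟ j ⌋) ≈ (1# - q) * (ind ⌊ l ≟ j ⌋ * qd l)
        *-comm-assoc l = solve 3 (λ f c δ → f :* (c :* δ) := c :* (δ :* f)) ≈-refl (qd l) (1# - q) _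

      private
        𝓛ₖ-cong : ∀ {k l j a bX bY y} →
                  ind (adj l j ∧ Bl k l ∧ Bl k j) ≈ a → ind (not ⌊ l ≟ j ⌋ ∧ X k l ∧ X k j) ≈ bX →
                  ind (not ⌊ l ≟ j ⌋ ∧ Y k l ∧ Y k j) ≈ bY → ind ⌊ l ≟ j ⌋ * bySide k l (nX k) (nY k) ≈ y →
                  𝓛ₖ k l j ≈ c₁ * (a * (1# / Δ G q k)) - c₂ * (bX * nX k + bY * nY k) - c₂ * y
        𝓛ₖ-cong a≈ bX≈ bY≈ y≈ =
          +-cong (+-cong (*-congˡ (*-congʳ a≈)) (-‿cong (*-congˡ (+-cong (*-congʳ bX≈) (*-congʳ bY≈)))))
                 (-‿cong (*-congˡ y≈))

      module _ {k : Fin r} {j : Fin N} where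

        𝓛ₖ-X : X k j ≡ true → Y k j ≡ false → ∀ l →
               𝓛ₖ k l j ≈ c₁ * (1# / Δ G q k) * ind (Y k l) - c₂ * nX k * ind (X k l) + c₂ * ind ⌊ l ≟ j ⌋
        𝓛ₖ-X j∈X j∉Y l = ≈-trans
          (𝓛ₖ-cong (reflexive (≡.cong ind (Sides.adj-in-block (XY-sides k) j∈X l))) (ind-∖ (X k) j∈X l) (ind-∉ (Y k) j∉Y l)
                   (≈-trans (ind-δ-cong (λ v → bySide k v (nX k) (nY k)) l) (*-congˡ (bySide-X j∈X j∉Y))))
          (solve 8 (λ c₁ c₂ e nX nY Y X δ →
                      c₁ :* (Y :* e) :- c₂ :* ((X :- δ) :* nX :+ con (+ 0) :* nY) :- c₂ :* (δ :* (nX :- con (+ 1)))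
                                         := c₁ :* e :* Y :- c₂ :* nX :* X :+ c₂ :* δ)
                 ≈-refl c₁ c₂ (1# / Δ G q k) (nX k) (nY k) (ind (Y k l)) (ind (X k l)) (ind ⌊ l ≟ j ⌋))

        𝓛ₖ-Y : X k j ≡ false → Y k j ≡ true → ∀ l →
               𝓛ₖ k l j ≈ c₁ * (1# / Δ G q k) * ind (X k l) - c₂ * nY k * ind (Y k l) + c₂ * ind ⌊ l ≟ j ⌋
        𝓛ₖ-Y j∉X j∈Y l = ≈-trans
          (𝓛ₖ-cong (reflexive (≡.cong ind (Sides.adj-in-block (Sides-swap (XY-sides k)) j∈Y l)))
                   (ind-∉ (X k) j∉X l) (ind-∖ (Y k) j∈Y l)
                   (≈-trans (ind-δ-cong (λ v → bySide k v (nX k) (nY k)) l) (*-congˡ (bySide-Y j∉X j∈Y))))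
          (solve 8 (λ c₁ c₂ e nX nY Y X δ →
                      c₁ :* (X :* e) :- c₂ :* (con (+ 0) :* nX :+ (Y :- δ) :* nY) :- c₂ :* (δ :* (nY :- con (+ 1)))
                                         := c₁ :* e :* X :- c₂ :* nY :* Y :+ c₂ :* δ)
                 ≈-refl c₁ c₂ (1# / Δ G q k) (nX k) (nY k) (ind (Y k l)) (ind (X k l)) (ind ⌊ l ≟ j ⌋))

        𝓛ₖ-out : X k j ≡ false → Y k j ≡ false → ∀ l → 𝓛ₖ k l j ≈ 0#
        𝓛ₖ-out j∉X j∉Y l = ≈-trans
          (𝓛ₖ-cong (reflexive (≡.cong ind adj-out)) (ind-∉ (X k) j∉X l) (ind-∉ (Y k) j∉Y l)
                   (≈-trans (ind-δ-cong (λ v → bySide k v (nX k) (nY k)) l) (*-congˡ (bySide-out j∉X j∉Y))))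
          (solve 6 (λ c₁ c₂ e nX nY δ →
                      c₁ :* (con (+ 0) :* e) :- c₂ :* (con (+ 0) :* nX :+ con (+ 0) :* nY) :- c₂ :* (δ :* con (+ 0))
                                      := con (+ 0))
                 ≈-refl c₁ c₂ (1# / Δ G q k) (nX k) (nY k) (ind ⌊ l ≟ j ⌋))
          where
          adj-out : adj l j ∧ Bl k l ∧ Bl k j ≡ false
          adj-out rewrite j∉X | j∉Y | ∧-zeroʳ (Bl k l) = ∧-zeroʳ (adj l j)

      sideSum : Subset N → Carrier
      sideSum S = sum (λ l → ind (S l) * qd l)

      module _ {k : Fin r} {P Q : Subset N} (sides : Sides k P Q) (g∈P : gate k ∈ₛ P) where

        sideSum-across-gate : sideSum Q ≈ ι (count Q) * E₁ (qd (gate k))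
        sideSum-across-gate = sum-ind-const Q λ l l∈Q →
          ≈-trans (reflexive (≡.cong (qnum q) (d-across-gate sides g∈P l∈Q))) (qnum-+1 (d i (gate k)))

        sideSum-beside-gate : sideSum P ≈ ι (count P) * E₂ (qd (gate k)) + (qd (gate k) - E₂ (qd (gate k)))
        sideSum-beside-gate = sum-ind-but-one P g∈P λ l l∈P l≢g →
          ≈-trans (reflexive (≡.cong (qnum q) (d-beside-gate sides g∈P l∈P l≢g))) (qnum-+2 (d i (gate k)))

      side-contribution : ∀ {k P Q j} → Sides k P Q → j ∈ₛ P →
                          Δ G q k ≈ q * q * (ι (count P) - 1#) * (ι (count Q) - 1#) - 1# →
                          sum (λ l → qd l * (c₁ * (1# / Δ G q k) * ind (Q l) - c₂ * ((ι (count Q) - 1#) / Δ G q k) * ind (P l)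
                                             + c₂ * ind ⌊ l ≟ j ⌋))
                            ≈ (q * (ι (count Q) - 1#) - 1#) / ((q + 1#) * Δ G q k) - 1# + ind (nonGate k j) * q ^ d i j
      side-contribution {k} {P} {Q} {j} sides j∈P Δ≈ = begin
        sum (λ l → qd l * (c₁ * (1# / Δ G q k) * ind (Q l) - c₂ * ((ι (count Q) - 1#) / Δ G q k) * ind (P l)
                           + c₂ * ind ⌊ l ≟ j ⌋))
          ≈⟨ sum-*-combination _ _ c₂ qd (ind ∘ Q) (ind ∘ P) (λ l → ind ⌊ l ≟ j ⌋) ⟩
        contribution (sideSum P) (sideSum Q) (sum (λ l → ind ⌊ l ≟ j ⌋ * qd l))
          ≈⟨ +-congˡ (*-congˡ (sum-δ j qd)) ⟩
        contribution (sideSum P) (sideSum Q) (qd j)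
          ≈⟨ by-gate-position (j ≟ gate k) (Bl⊆P∪Q (gate-∈ k)) ⟩
        xEntry + ind (nonGate k j) * q ^ d i j
          ∎
        where
        open BlockAlgebra (ι (count P)) (ι (count Q)) (Δ G q k) q+1≉0 (Δ≉0 k) Δ≈
        open Sides sides using (Bl⊆P∪Q; P⊆Bl; P-∉Q)

        t : Carrier
        t = qd (gate k)

        by-gate-position : Dec (j ≡ gate k) → gate k ∈ₛ P ⊎ gate k ∈ₛ Q →
                           contribution (sideSum P) (sideSum Q) (qd j) ≈ xEntry + ind (nonGate k j) * q ^ d i j
        by-gate-position (yes refl) (inj₁ g∈P) = begin
          contribution (sideSum P) (sideSum Q) t
            ≈⟨ contribution-cong (sideSum-beside-gate sides g∈P) (sideSum-across-gate sides g∈P) ≈-refl ⟩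
          contribution (ι (count P) * E₂ t + (t - E₂ t)) (ι (count Q) * E₁ t) t
            ≈⟨ at-gate t ⟩
          xEntry + 0#
            ≈⟨ +-congˡ (zeroˡ _) ⟨
          xEntry + 0# * q ^ d i j
            ≡⟨ ≡.cong (λ b → xEntry + ind b * q ^ d i j) (nonGate-at-gate k) ⟨
          xEntry + ind (nonGate k (gate k)) * q ^ d i j
            ∎
        by-gate-position (yes refl) (inj₂ g∈Q) = ⊥-elim (true⇒≢false g∈Q (P-∉Q j∈P))
        by-gate-position (no j≢g) (inj₁ g∈P) = begin
          contribution (sideSum P) (sideSum Q) (qd j)
            ≈⟨ contribution-cong (sideSum-beside-gate sides g∈P) (sideSum-across-gate sides g∈P) qd-j ⟩
          contribution (ι (count P) * E₂ t + (t - E₂ t)) (ι (count Q) * E₁ t) (E₂ t)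
            ≈⟨ beside-gate t ⟩
          xEntry + q * q * (1# + (q - 1#) * t)
            ≈⟨ +-congˡ (≈-trans (*-identityˡ _) (≈-trans (reflexive (≡.cong (q ^_) d-j)) (^-+2 (d i (gate k))))) ⟨
          xEntry + 1# * q ^ d i j
            ≡⟨ ≡.cong (λ b → xEntry + ind b * q ^ d i j) (∈-∖ₛ (Bl k) (P⊆Bl j∈P) j≢g) ⟨
          xEntry + ind (nonGate k j) * q ^ d i j
            ∎
          where
          d-j : d i j ≡ d i (gate k) ℕ.+ 2
          d-j = d-beside-gate sides g∈P j∈P j≢g
          qd-j : qd j ≈ E₂ t
          qd-j = ≈-trans (reflexive (≡.cong (qnum q) d-j)) (qnum-+2 (d i (gate k)))
        by-gate-position (no j≢g) (inj₂ g∈Q) = begin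
          contribution (sideSum P) (sideSum Q) (qd j)
            ≈⟨ contribution-cong (sideSum-across-gate sides′ g∈Q) (sideSum-beside-gate sides′ g∈Q) qd-j ⟩
          contribution (ι (count P) * E₁ t) (ι (count Q) * E₂ t + (t - E₂ t)) (E₁ t)
            ≈⟨ across-gate t ⟩
          xEntry + q * (1# + (q - 1#) * t)
            ≈⟨ +-congˡ (≈-trans (*-identityˡ _) (≈-trans (reflexive (≡.cong (q ^_) d-j)) (^-+1 (d i (gate k))))) ⟨
          xEntry + 1# * q ^ d i j
            ≡⟨ ≡.cong (λ b → xEntry + ind b * q ^ d i j) (∈-∖ₛ (Bl k) (P⊆Bl j∈P) j≢g) ⟨
          xEntry + ind (nonGate k j) * q ^ d i j
            ∎
          where
          sides′ : Sides k Q P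
          sides′ = Sides-swap sides
          d-j : d i j ≡ d i (gate k) ℕ.+ 1
          d-j = d-across-gate sides′ g∈Q j∈P
          qd-j : qd j ≈ E₁ t
          qd-j = ≈-trans (reflexive (≡.cong (qnum q) d-j)) (qnum-+1 (d i (gate k)))

      block-contribution : ∀ k j → sum (λ l → qd l * 𝓛ₖ k l j) ≈ bySide k j (xX k) (xY k) + ind (nonGate k j) * q ^ d i j
      block-contribution k j = by-side (X k j) (Y k j) ≡.refl ≡.refl
        where
        by-side : ∀ x y → X k j ≡ x → Y k j ≡ y →
                  sum (λ l → qd l * 𝓛ₖ k l j) ≈ bySide k j (xX k) (xY k) + ind (nonGate k j) * q ^ d i j
        by-side true  true  j∈X j∈Y = ⊥-elim (disjoint k j j∈X j∈Y)
        by-side true  false j∈X j∉Y = begin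
          sum (λ l → qd l * 𝓛ₖ k l j)
            ≈⟨ sum-cong {N} (λ l → *-congˡ (𝓛ₖ-X j∈X j∉Y l)) ⟩
          _
            ≈⟨ side-contribution (XY-sides k) j∈X ≈-refl ⟩
          xX k - 1# + ind (nonGate k j) * q ^ d i j
            ≈⟨ +-congʳ (bySide-X j∈X j∉Y) ⟨
          bySide k j (xX k) (xY k) + ind (nonGate k j) * q ^ d i j
            ∎
        by-side false true  j∉X j∈Y = begin
          sum (λ l → qd l * 𝓛ₖ k l j)
            ≈⟨ sum-cong {N} (λ l → *-congˡ (𝓛ₖ-Y j∉X j∈Y l)) ⟩
          _
            ≈⟨ side-contribution (Sides-swap (XY-sides k)) j∈Y Δ≈ ⟩
          xY k - 1# + ind (nonGate k j) * q ^ d i j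
            ≈⟨ +-congʳ (bySide-Y j∉X j∈Y) ⟨
          bySide k j (xX k) (xY k) + ind (nonGate k j) * q ^ d i j
            ∎
          where
          Δ≈ : Δ G q k ≈ q * q * (ι (n k) - 1#) * (ι (m k) - 1#) - 1#
          Δ≈ = solve 3 (λ q a b → q :* q :* (a :- con (+ 1)) :* (b :- con (+ 1)) :- con (+ 1)
                                := q :* q :* (b :- con (+ 1)) :* (a :- con (+ 1)) :- con (+ 1)) ≈-refl q (ι (m k)) (ι (n k))
        by-side false false j∉X j∉Y = begin
          sum (λ l → qd l * 𝓛ₖ k l j)
            ≈⟨ sum-cong {N} (λ l → ≈-trans (*-congˡ (𝓛ₖ-out j∉X j∉Y l)) (zeroʳ _)) ⟩
          sum {N} (λ _ → 0#)
            ≈⟨ sum-replicate-zero N ⟩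
          0#
            ≈⟨ ≈-trans (+-cong (bySide-out j∉X j∉Y) (zeroˡ _)) (+-identityʳ 0#) ⟨
          bySide k j (xX k) (xY k) + 0# * q ^ d i j
            ≡⟨ ≡.cong (λ b → bySide k j (xX k) (xY k) + ind (b ∧ not ⌊ j ≟ gate k ⌋) * q ^ d i j) (cong₂ _∨_ j∉X j∉Y) ⟨
          bySide k j (xX k) (xY k) + ind (nonGate k j) * q ^ d i j
            ∎

      blocks-total : ∀ j → sum (λ k → sum (λ l → qd l * 𝓛ₖ k l j))
                             ≈ sum (λ k → bySide k j (xX k) (xY k)) + ι (nonGates j) * q ^ d i j
      blocks-total j = begin
        sum (λ k → sum (λ l → qd l * 𝓛ₖ k l j))
          ≈⟨ sum-cong {r} (λ k → block-contribution k j) ⟩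
        sum (λ k → bySide k j (xX k) (xY k) + ind (nonGate k j) * q ^ d i j)
          ≈⟨ ∑-distrib-+ {r} (λ k → bySide k j (xX k) (xY k)) _ ⟩
        sum (λ k → bySide k j (xX k) (xY k)) + sum (λ k → ind (nonGate k j) * q ^ d i j)
          ≈⟨ +-congˡ (sum-ind (λ k → nonGate k j) _) ⟩
        sum (λ k → bySide k j (xX k) (xY k)) + ι (nonGates j) * q ^ d i j
          ∎

      diagonal-correction : ∀ j → nonGates j ≡ indℕ (not ⌊ j ≟ i ⌋) →
                            ι (nonGates j) * q ^ d i j + ((1# - q) * qd j + ind ⌊ i ≟ j ⌋) ≈ 1#
      diagonal-correction j nonGates≡ rewrite nonGates≡ with j ≟ i
      ... | yes refl rewrite d-refl i | isYes-true (i ≟ i) refl =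
        solve 1 (λ q → con (+ 0) :* con (+ 1) :+ ((con (+ 1) :- q) :* con (+ 0) :+ con (+ 1)) := con (+ 1)) ≈-refl q
      ... | no j≢i rewrite isYes-false (i ≟ j) (j≢i ∘ ≡.sym) = begin
        (1# + 0#) * q ^ d i j + ((1# - q) * qd j + 0#)              ≈⟨ +-congʳ (*-congˡ (^≈1+[q-1]qnum (d i j))) ⟩
        (1# + 0#) * (1# + (q - 1#) * qd j) + ((1# - q) * qd j + 0#) ≈⟨ solve 2 (λ q t →
          (con (+ 1) :+ con (+ 0)) :* (con (+ 1) :+ (q :- con (+ 1)) :* t) :+ ((con (+ 1) :- q) :* t :+ con (+ 0))
            := con (+ 1)) ≈-refl q (qd j) ⟩
        1#                                                          ∎

theorem5p8 : ∀ {c ℓ} (F : Field c ℓ) (N r : ℕ) (G : BiBlockGraph N r) (q : Field.Carrier F) →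
  let open Field F
      open QData F
      open BiBlockGraph G
  in 1 < r →
     N ≡ (sumℕ (λ k → m k ℕ.+ n k) ℕ.∸ r) ℕ.+ 1 →
     ¬ (q + 1# ≈ 0#) →
     (∀ k → ¬ (q * q * (ι (m k) - 1#) * (ι (n k) - 1#) ≈ 1#)) →
     (∀ k → ¬ ((q + 1#) * (q + 1#) * (ι (m k) - 1#) * (ι (n k) - 1#) ≈ ι (m k) * ι (n k))) →
     (d : Fin N → Fin N → ℕ) → IsDistance graph d →
     ∀ i j → ((𝓓 G q d ⊗ 𝓛 G q) ⊕ Id) i j ≈ xvec G q j
theorem5p8 F N r G q _ N≡ q+1≉0 Δ≉1 _ d isD i j = begin
  sum (λ l → qd l * 𝓛 G q l j) + ind ⌊ i ≟ j ⌋
    ≈⟨ +-congʳ (row-by-blocks j) ⟩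
  sum (λ k → sum (λ l → qd l * 𝓛ₖ k l j)) + (1# - q) * qd j + ind ⌊ i ≟ j ⌋
    ≈⟨ +-congʳ (+-congʳ (blocks-total j)) ⟩
  Σx + ι (nonGates j) * q ^ d i j + (1# - q) * qd j + ind ⌊ i ≟ j ⌋
    ≈⟨ ≈-trans (+-assoc _ _ _) (+-assoc _ _ _) ⟩
  Σx + (ι (nonGates j) * q ^ d i j + ((1# - q) * qd j + ind ⌊ i ≟ j ⌋))
    ≈⟨ +-congˡ (diagonal-correction j (nonGates≡ N≡ j)) ⟩
  Σx + 1#
    ≈⟨ sum-bySide j xX xY ⟨
  xvec G q j
    ∎
  where
  open Field F renaming (refl to ≈-refl; sym to ≈-sym; trans to ≈-trans)
  open QData F
  open import Relation.Binary.Reasoning.Setoid setoid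
  open Column F q G q+1≉0 Δ≉1 d isD i
  open Gates G d isD i using (nonGates; nonGates≡)

  Σx : Carrier
  Σx = sum (λ k → bySide k j (xX k) (xY k))
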